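{- Let $\Pi$ be a partition of $[n]$ with at least two blocks. Let $c := |[1]_{\widehat\Pi}|$ and $d := |[n]_{\widehat\Pi}|$, and assume $S_\Pi \ne S_n^{c,d}$. Then for an integer $i\ge 1$, we have $\mathrm{Comp}_{n+i}(S_\Pi) = S^{c,d}_{n+i}$ or $\mathrm{Comp}_{n+i}(S_\Pi) = \langle S^{c,d}_{n+i},\delta_{n+i}\rangle$ if and only if $i \ge \max(M(\Pi)-1,1)$.
   Context: $S_n$ is the symmetric group on $[n]=\{1,\dots,n\}$; $\delta_n$ is $i\mapsto n+1-i$. For a partition $\Pi$ of $[n]$, $S_\Pi=\{\pi\in S_n: \pi(B)=B \text{ for all } B\in\Pi\}$. $\widehat{\Pi}$ is the coarsest partition of $[n]$ into intervals refining $\Pi$; $[1]_{\widehat\Pi}$ and $[n]_{\widehat\Pi}$ are its blocks containing $1$ and $n$. $M(\Pi)$ is the maximum of $1$ and the sizes of the blocks of $\widehat\Pi$ other than $[1]_{\widehat\Pi}$ and $[n]_{\widehat\Pi}$. For positive integers $a,b$ with $a+b\le m$, $S^{a,b}_m$ is the group of permutations of $[m]$ that map each of the intervals $\{1,\dots,a\}$ and $\{m-b+1,\dots,m\}$ onto itself and fix every point of $\{a+1,\dots,m-b\}$. A permutation $\pi\in S_m$ involves $\tau\in S_n$ ($n\le m$) if there are indices $i_1<\dots<i_n$ with $\pi(i_j)<\pi(i_k)$ iff $\tau(j)<\tau(k)$ for all $j,k$; such $\tau$ is an $n$-pattern of $\pi$. For $S\subseteq S_n$, $\mathrm{Comp}_m(S)$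 is the set of $\tau\in S_m$ all of whose $n$-patterns belong to $S$. -}

module Defs where

open import Data.Nat using (ℕ; zero; suc; _+_; _∸_; _≤_; _<_; _⊔_; _⊓_; _≤ᵇ_; _≡ᵇ_)
open import Data.Bool using (Bool; true; false; not; _∧_; _∨_; if_then_else_)
open import Data.Fin using (Fin; toℕ; opposite)
open import Data.Fin.Permutation using (Permutation′; _⟨$⟩ʳ_; _∘ₚ_; flip)
open import Data.List using (List; allFin; filter; length; foldr; map)
open import Data.Bool.ListAction using (and)
open import Data.Product using (Σ; ∃; _×_; _,_)
open import Relation.Binary.PropositionalEquality using (_≡_; _≢_)
open import Relation.Nullary using (¬_)
open import Data.Bool using (T)
open import Relation.Nullary.Decidable using (T?)
open import Function.Bundles using (_⇔_)

-- Permutations of [n] (0-based: Fin n stands for {1,…,n}).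
Perm : ℕ → Set
Perm n = Permutation′ n

PermSet : ℕ → Set₁
PermSet n = Perm n → Set

_≐_ : ∀ {n} → PermSet n → PermSet n → Set
A ≐ B = ∀ π → A π ⇔ B π

MapsOnto : ∀ {n} → Perm n → (Fin n → Set) → Set
MapsOnto {n} π P =
  (∀ i → P i → P (π ⟨$⟩ʳ i)) × (∀ j → P j → Σ (Fin n) λ i → P i × (π ⟨$⟩ʳ i ≡ j))

-- A partition Π of [n] is given by a labelling  f : Fin n → ℕ ; its blocks
-- are the (nonempty) fibres  {x | f x ≡ f b}.
Partition : ℕ → Set
Partition n = Fin n → ℕ

AtLeastTwoBlocks : ∀ {n} → Partition n → Set
AtLeastTwoBlocks {n} f = Σ (Fin n) λ i → Σ (Fin n) λ j → f i ≢ f j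

S_Π : ∀ {n} → Partition n → PermSet n
S_Π {n} f π = ∀ (b : Fin n) → MapsOnto π (λ x → f x ≡ f b)

-- S^{a,b}_m : maps {1..a} and {m-b+1..m} onto themselves, fixes {a+1..m-b}.
-- (0-based: positions < a, positions ≥ m ∸ b, and the positions in between.)
S^ : (a b m : ℕ) → PermSet m
S^ a b m π =
  MapsOnto π (λ x → toℕ x < a) ×
  MapsOnto π (λ x → m ∸ b ≤ toℕ x) ×
  (∀ x → a ≤ toℕ x → toℕ x < m ∸ b → π ⟨$⟩ʳ x ≡ x)

-- δ_m : i ↦ m+1-i  (0-based: i ↦ m-1-i, which is Data.Fin.opposite).
-- Subgroup ⟨G, δ_m⟩ of S_m generated by a set G and δ_m.
data Generated {m : ℕ} (G : PermSet m) : PermSet m where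
  gen  : ∀ π → G π → Generated G π
  δgen : ∀ π → (∀ x → π ⟨$⟩ʳ x ≡ opposite x) → Generated G π
  comp : ∀ π σ → Generated G π → Generated G σ → Generated G (π ∘ₚ σ)
  inv  : ∀ π → Generated G π → Generated G (flip π)
  ext  : ∀ π σ → (∀ x → π ⟨$⟩ʳ x ≡ σ ⟨$⟩ʳ x) → Generated G π → Generated G σ

Involves : ∀ {m n} → Perm m → Perm n → Set
Involves {m} {n} π τ =
  Σ (Fin n → Fin m) λ e →
    (∀ j k → toℕ j < toℕ k → toℕ (e j) < toℕ (e k)) ×
    (∀ j k → (toℕ (π ⟨$⟩ʳ e j) < toℕ (π ⟨$⟩ʳ e k)) ⇔ (toℕ (τ ⟨$⟩ʳ j) < toℕ (τ ⟨$⟩ʳ k)))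

Comp : ∀ {n} (m : ℕ) → PermSet n → PermSet m
Comp {n} m S π = ∀ (τ : Perm n) → Involves π τ → S τ

-- The coarsest interval partition Π̂ refining Π: positions i, j (0-based,
-- as naturals) lie in the same block of Π̂ iff all positions between
-- them carry the same Π-label (i.e. the closed interval between them lies
-- in one block of Π).
between : ℕ → ℕ → ℕ → Bool
between i j k = ((i ⊓ j) ≤ᵇ k) ∧ (k ≤ᵇ (i ⊔ j))

sameHat : ∀ {n} → Partition n → ℕ → ℕ → Bool
sameHat {n} f i j =
  and (map (λ k → and (map (λ l → not (between i j (toℕ k)) ∨ not (between i j (toℕ l))
                         ∨ (f k ≡ᵇ f l)) (allFin n))) (allFin n))

hatBlockSize : ∀ {n} → Partition n → ℕ → ℕ
hatBlockSize {n} f i = length (filter (λ j → T? (sameHat f i (toℕ j))) (allFin n))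

cOf : ∀ {n} → Partition n → ℕ
cOf f = hatBlockSize f 0

dOf : ∀ {n} → Partition n → ℕ
dOf {n} f = hatBlockSize f (n ∸ 1)

MOf : ∀ {n} → Partition n → ℕ
MOf {n} f =
  foldr (λ j acc →
          if sameHat f 0 (toℕ j) ∨ sameHat f (n ∸ 1) (toℕ j)
          then acc else (hatBlockSize f (toℕ j) ⊔ acc))
        1 (allFin n)

-- Positions are 0-based. The blocks of Π̂ are the intervals between consecutive boundaries,
-- the positions where the label of Π changes; c is the first boundary and n − d the last.
--
-- Deleting a point of π ∈ Comp_{n+i}(S_Π) gives an element of Comp_{n+i−1}(S_Π). If π sends
-- its first point below its last one, induction on i shows that π keeps every cut at a
-- position within distance i after a boundary: the deletions keep such cuts for i − 1, so they
-- preserve a refined labelling whose boundaries are exactly the positions within distance i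
-- after a boundary of Π̂, and a permutation all of whose deletions preserve a labelling keeps
-- the cut at each boundary of that labelling. When every inner block of Π̂ has at most i + 1
-- points these cuts fix the whole middle, so π ∈ S^{c,d}; if π sends its first point above its
-- last one, Π̂ is a palindrome, c = d, and composing with δ reduces to the first case. Conversely, if an inner
-- block [s, s') has more than i + 1 points, the transposition of s + i and s' − 1 lies in
-- Comp_{n+i}(S_Π) but moves a middle point while fixing two others, s and s', so it is neither
-- in S^{c,d} nor in ⟨S^{c,d}, δ⟩.
module Submission where

open import Defs
open import Data.Nat using (ℕ; zero; suc; _+_; _∸_; _≤_; _<_; _⊔_; _⊓_; _<ᵇ_; z≤n; s≤s; _≤?_; _<?_)
open import Data.Nat.Properties
open import Data.Fin using (Fin; toℕ; fromℕ<; fromℕ; inject₁; opposite; punchIn; punchOut)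
import Data.Fin as F
import Data.Fin.Properties as FP
open import Data.Fin.Permutation using (_⟨$⟩ʳ_; _⟨$⟩ˡ_; _∘ₚ_; flip; remove; inverseˡ; inverseʳ; transpose; reverse)
import Data.Fin.Permutation.Components as PC
open import Data.Bool using (Bool; true; false; not; _∨_; if_then_else_; T)
import Data.Bool.Properties as BP
open import Data.Bool.ListAction using (and)
open import Data.List using (allFin; filter; length; foldr; map; tabulate)
import Data.List.Relation.Unary.All.Properties as AllP
open import Data.Product using (Σ; _×_; _,_; proj₁; proj₂)
open import Data.Sum using (_⊎_; inj₁; inj₂; [_,_]′)
open import Data.Sum.Properties using (inj₁-injective)
open import Data.Empty using (⊥; ⊥-elim)
open import Data.Unit using (tt)
open import Relation.Binary.PropositionalEquality using (_≡_; _≢_; refl; sym; trans; cong; cong₂; subst; subst₂; module ≡-Reasoning)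
open import Relation.Binary.Definitions using (tri<; tri≈; tri>)
open import Relation.Nullary using (¬_; Dec; yes; no; _×-dec_; ¬?)
open import Relation.Nullary.Decidable using (T?)
open import Function.Base using (_∘_; id)
open import Function.Bundles using (_⇔_; mk⇔; Equivalence)

open Equivalence using () renaming (to to ⇔to; from to ⇔from)

image : ∀ {m} → Perm m → Fin m → ℕ
image ρ x = toℕ (ρ ⟨$⟩ʳ x)

image-injective : ∀ {m} (ρ : Perm m) {x y : Fin m} → image ρ x ≡ image ρ y → x ≡ y
image-injective ρ {x} {y} e = trans (sym (inverseˡ ρ)) (trans (cong (ρ ⟨$⟩ˡ_) (FP.toℕ-injective e)) (inverseˡ ρ))

image-≢ : ∀ {m} (ρ : Perm m) {x y} → x ≢ y → image ρ x ≢ image ρ y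
image-≢ ρ ne e = ne (image-injective ρ e)

image< : ∀ {m} (ρ : Perm m) x → image ρ x < m
image< ρ x = FP.toℕ<n (ρ ⟨$⟩ʳ x)

≤pred : ∀ {a b} → a < b → a ≤ b ∸ 1
≤pred (s≤s a≤b) = a≤b

suc-∸1 : ∀ {a} → 1 ≤ a → suc (a ∸ 1) ≡ a
suc-∸1 (s≤s _) = refl

opposite-< : ∀ {m} (a b : Fin m) → toℕ a < toℕ b → toℕ (opposite b) < toℕ (opposite a)
opposite-< {m} a b lt = subst₂ _<_ (sym (FP.opposite-prop b)) (sym (FP.opposite-prop a)) (∸-monoʳ-< (s≤s lt) (FP.toℕ<n b))

opposite-<⁻ : ∀ {m} (a b : Fin m) → toℕ (opposite b) < toℕ (opposite a) → toℕ a < toℕ b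
opposite-<⁻ a b lt with <-cmp (toℕ a) (toℕ b)
... | tri< p _ _ = p
... | tri≈ _ p _ = ⊥-elim (<-irrefl (cong toℕ (cong opposite (FP.toℕ-injective (sym p)))) lt)
... | tri> _ _ p = ⊥-elim (<-asym lt (opposite-< b a p))

punchOutℕ : ℕ → ℕ → ℕ
punchOutℕ a b = if a <ᵇ b then b ∸ 1 else b

punchOutℕ-< : ∀ {a b} → a < b → punchOutℕ a b ≡ b ∸ 1
punchOutℕ-< {a} {b} a<b with a <ᵇ b in eq
... | true = refl
... | false = ⊥-elim (subst T eq (<⇒<ᵇ a<b))

punchOutℕ-≥ : ∀ {a b} → b ≤ a → punchOutℕ a b ≡ b
punchOutℕ-≥ {a} {b} b≤a with a <ᵇ b in eq
... | true = ⊥-elim (<⇒≱ (<ᵇ⇒< a b (subst T (sym eq) tt)) b≤a)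
... | false = refl

punchOutℕ≤ : ∀ a u → punchOutℕ a u ≤ u
punchOutℕ≤ a u with a <ᵇ u
... | true = m∸n≤m u 1
... | false = ≤-refl

∸1≤punchOutℕ : ∀ a u → u ∸ 1 ≤ punchOutℕ a u
∸1≤punchOutℕ a u with a <ᵇ u
... | true = ≤-refl
... | false = m∸n≤m u 1

punchOutℕ-mono-< : ∀ {a u v} → a ≢ u → a ≢ v → u < v → punchOutℕ a u < punchOutℕ a v
punchOutℕ-mono-< {a} {u} {v} a≢u a≢v u<v with <-cmp a u | <-cmp a v
... | tri≈ _ a≡u _ | _          = ⊥-elim (a≢u a≡u)
... | _            | tri≈ _ a≡v _ = ⊥-elim (a≢v a≡v)
... | tri< a<u _ _ | tri< a<v _ _ rewrite punchOutℕ-< a<u | punchOutℕ-< a<v = ∸-monoˡ-< u<v (<-≤-trans (s≤s z≤n) a<u)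
... | tri< a<u _ _ | tri> _ _ v<a = ⊥-elim (<-asym (<-trans a<u u<v) v<a)
... | tri> _ _ u<a | tri< a<v _ _ rewrite punchOutℕ-≥ (<⇒≤ u<a) | punchOutℕ-< a<v = <-≤-trans u<a (≤pred a<v)
... | tri> _ _ u<a | tri> _ _ v<a rewrite punchOutℕ-≥ (<⇒≤ u<a) | punchOutℕ-≥ (<⇒≤ v<a) = u<v

punchOutℕ-cancel-< : ∀ {a u v} → a ≢ u → a ≢ v → punchOutℕ a u < punchOutℕ a v → u < v
punchOutℕ-cancel-< {a} {u} {v} a≢u a≢v lt with <-cmp u v
... | tri< u<v _ _ = u<v
... | tri≈ _ refl _ = ⊥-elim (<-irrefl refl lt)
... | tri> _ _ v<u = ⊥-elim (<-asym lt (punchOutℕ-mono-< a≢v a≢u v<u))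

punchOutℕ-complement : ∀ {n a u} → a ≤ n → u ≤ n → a ≢ u → n ∸ 1 ∸ punchOutℕ a u ≡ punchOutℕ (n ∸ a) (n ∸ u)
punchOutℕ-complement {n} {a} {u} a≤n u≤n a≢u with <-cmp a u
... | tri< a<u _ _ = begin
  n ∸ 1 ∸ punchOutℕ a u        ≡⟨ cong (λ z → n ∸ 1 ∸ z) (punchOutℕ-< a<u) ⟩
  n ∸ 1 ∸ (u ∸ 1)              ≡⟨ ∸∸1 u≤n a<u ⟩
  n ∸ u                        ≡⟨ punchOutℕ-≥ (∸-monoʳ-≤ n (<⇒≤ a<u)) ⟨
  punchOutℕ (n ∸ a) (n ∸ u)    ∎
  where
  open ≡-Reasoning
  ∸∸1 : ∀ {u a} → u ≤ n → a < u → n ∸ 1 ∸ (u ∸ 1) ≡ n ∸ u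
  ∸∸1 {suc u} _ _ = ∸-+-assoc n 1 u
... | tri≈ _ a≡u _ = ⊥-elim (a≢u a≡u)
... | tri> _ _ u<a = begin
  n ∸ 1 ∸ punchOutℕ a u        ≡⟨ cong (λ z → n ∸ 1 ∸ z) (punchOutℕ-≥ (<⇒≤ u<a)) ⟩
  n ∸ 1 ∸ u                    ≡⟨ ∸-+-assoc n 1 u ⟩
  n ∸ suc u                    ≡⟨ trans (∸-+-assoc n u 1) (cong (n ∸_) (+-comm u 1)) ⟨
  n ∸ u ∸ 1                    ≡⟨ punchOutℕ-< (∸-monoʳ-< u<a a≤n) ⟨
  punchOutℕ (n ∸ a) (n ∸ u)    ∎
  where open ≡-Reasoning

toℕ-punchOut : ∀ {n} {i j : Fin (suc n)} (i≢j : i ≢ j) → toℕ (punchOut i≢j) ≡ punchOutℕ (toℕ i) (toℕ j)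
toℕ-punchOut {n} {F.zero} {F.zero} i≢j = ⊥-elim (i≢j refl)
toℕ-punchOut {n} {F.zero} {F.suc j} i≢j = refl
toℕ-punchOut {suc n} {F.suc i} {F.zero} i≢j = refl
toℕ-punchOut {suc n} {F.suc i} {F.suc j} i≢j =
  trans (cong suc (toℕ-punchOut (i≢j ∘ cong F.suc))) (suc-punchOutℕ (λ e → i≢j (cong F.suc (FP.toℕ-injective e))))
  where
  suc-punchOutℕ : ∀ {a b} → a ≢ b → suc (punchOutℕ a b) ≡ punchOutℕ (suc a) (suc b)
  suc-punchOutℕ {a} {b} a≢b with <-cmp a b
  ... | tri< a<b _ _ rewrite punchOutℕ-< a<b | punchOutℕ-< (s≤s a<b) = suc-∸1 (<-≤-trans (s≤s z≤n) a<b)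
  ... | tri≈ _ a≡b _ = ⊥-elim (a≢b a≡b)
  ... | tri> _ _ b<a rewrite punchOutℕ-≥ (<⇒≤ b<a) | punchOutℕ-≥ (s≤s (<⇒≤ b<a)) = refl

punchInℕ : ℕ → ℕ → ℕ
punchInℕ x j = if j <ᵇ x then j else suc j

punchInℕ-< : ∀ {x j} → j < x → punchInℕ x j ≡ j
punchInℕ-< {x} {j} lt with j <ᵇ x in eq
... | true = refl
... | false = ⊥-elim (subst T eq (<⇒<ᵇ lt))

punchInℕ-≥ : ∀ {x j} → x ≤ j → punchInℕ x j ≡ suc j
punchInℕ-≥ {x} {j} le with j <ᵇ x in eq
... | true = ⊥-elim (<⇒≱ (<ᵇ⇒< j x (subst T (sym eq) tt)) le)
... | false = refl

toℕ-punchIn-< : ∀ {n} (i : Fin (suc n)) (j : Fin n) → toℕ j < toℕ i → toℕ (punchIn i j) ≡ toℕ j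
toℕ-punchIn-< (F.suc i) F.zero _ = refl
toℕ-punchIn-< (F.suc i) (F.suc j) (s≤s lt) = cong suc (toℕ-punchIn-< i j lt)

toℕ-punchIn-≥ : ∀ {n} (i : Fin (suc n)) (j : Fin n) → toℕ i ≤ toℕ j → toℕ (punchIn i j) ≡ suc (toℕ j)
toℕ-punchIn-≥ F.zero j _ = refl
toℕ-punchIn-≥ (F.suc i) (F.suc j) (s≤s le) = cong suc (toℕ-punchIn-≥ i j le)

toℕ-punchIn : ∀ {n} (i : Fin (suc n)) (j : Fin n) → toℕ (punchIn i j) ≡ punchInℕ (toℕ i) (toℕ j)
toℕ-punchIn i j with toℕ j <? toℕ i
... | yes j<i = trans (toℕ-punchIn-< i j j<i) (sym (punchInℕ-< j<i))
... | no j≮i = trans (toℕ-punchIn-≥ i j (≮⇒≥ j≮i)) (sym (punchInℕ-≥ (≮⇒≥ j≮i)))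

image-remove : ∀ {m} (x : Fin (suc m)) (ρ : Perm (suc m)) (j : Fin m) →
  image (remove x ρ) j ≡ punchOutℕ (image ρ x) (image ρ (punchIn x j))
image-remove x ρ j = toℕ-punchOut {i = ρ ⟨$⟩ʳ x} {j = ρ ⟨$⟩ʳ punchIn x j} _

remove-< : ∀ {m} (x : Fin (suc m)) (ρ : Perm (suc m)) (j j' : Fin m) →
  image ρ (punchIn x j) < image ρ (punchIn x j') → image (remove x ρ) j < image (remove x ρ) j'
remove-< x ρ j j' lt = subst₂ _<_ (sym (image-remove x ρ j)) (sym (image-remove x ρ j'))
  (punchOutℕ-mono-< (image-≢ ρ (λ e → FP.punchInᵢ≢i x j (sym e))) (image-≢ ρ (λ e → FP.punchInᵢ≢i x j' (sym e))) lt)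

remove-<⁻ : ∀ {m} (x : Fin (suc m)) (ρ : Perm (suc m)) (j j' : Fin m) →
  image (remove x ρ) j < image (remove x ρ) j' → image ρ (punchIn x j) < image ρ (punchIn x j')
remove-<⁻ x ρ j j' lt = punchOutℕ-cancel-< (image-≢ ρ (λ e → FP.punchInᵢ≢i x j (sym e))) (image-≢ ρ (λ e → FP.punchInᵢ≢i x j' (sym e)))
  (subst₂ _<_ (image-remove x ρ j) (image-remove x ρ j') lt)

Preserves : ∀ {m} {A : Set} → (ℕ → A) → Perm m → Set
Preserves G ρ = ∀ j → G (image ρ j) ≡ G (toℕ j)

preserves-remove : ∀ {m} {A : Set} (G : ℕ → A) (ρ : Perm (suc m)) (x p : Fin (suc m)) →
  Preserves G (remove x ρ) → (x≢p : x ≢ p) →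
  G (punchOutℕ (image ρ x) (image ρ p)) ≡ G (punchOutℕ (toℕ x) (toℕ p))
preserves-remove G ρ x p pres x≢p = begin
  G (punchOutℕ (image ρ x) (image ρ p))                          ≡⟨ cong (λ z → G (punchOutℕ (image ρ x) (image ρ z))) (FP.punchIn-punchOut x≢p) ⟨
  G (punchOutℕ (image ρ x) (image ρ (punchIn x (punchOut x≢p)))) ≡⟨ cong G (image-remove x ρ (punchOut x≢p)) ⟨
  G (image (remove x ρ) (punchOut x≢p))                           ≡⟨ pres (punchOut x≢p) ⟩
  G (toℕ (punchOut x≢p))                                          ≡⟨ cong G (toℕ-punchOut x≢p) ⟩
  G (punchOutℕ (toℕ x) (toℕ p))                                   ∎
  where open ≡-Reasoning

StrictlyIncreasing : ∀ {n m} → (Fin n → Fin m) → Set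
StrictlyIncreasing e = ∀ j k → toℕ j < toℕ k → toℕ (e j) < toℕ (e k)

injection-interval-≤ : ∀ {N} (h : Fin N → ℕ) (lo hi lo' hi' : ℕ) → hi ≤ N →
  (∀ x → lo ≤ toℕ x → toℕ x < hi → lo' ≤ h x × h x < hi') →
  (∀ {x y} → h x ≡ h y → x ≡ y) →
  hi ∸ lo ≤ hi' ∸ lo'
injection-interval-≤ {N} h lo hi lo' hi' hi≤N range inj = FP.injective⇒≤ {f = g} g-injective
  where
  lo≤hi : Fin (hi ∸ lo) → lo ≤ hi
  lo≤hi k with lo ≤? hi
  ... | yes lo≤hi = lo≤hi
  ... | no lo≰hi = ⊥-elim (FP.¬Fin0 (subst Fin (m≤n⇒m∸n≡0 (≰⇒≥ lo≰hi)) k))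
  shift< : (k : Fin (hi ∸ lo)) → lo + toℕ k < hi
  shift< k = subst (lo + toℕ k <_) (m+[n∸m]≡n (lo≤hi k)) (+-monoʳ-< lo (FP.toℕ<n k))
  shift : Fin (hi ∸ lo) → Fin N
  shift k = fromℕ< (<-≤-trans (shift< k) hi≤N)
  toℕ-shift : ∀ k → toℕ (shift k) ≡ lo + toℕ k
  toℕ-shift k = FP.toℕ-fromℕ< _
  range-shift : ∀ k → lo' ≤ h (shift k) × h (shift k) < hi'
  range-shift k = range (shift k) (subst (lo ≤_) (sym (toℕ-shift k)) (m≤m+n lo (toℕ k)))
                                  (subst (_< hi) (sym (toℕ-shift k)) (shift< k))
  g< : ∀ k → h (shift k) ∸ lo' < hi' ∸ lo'
  g< k = ∸-monoˡ-< (proj₂ (range-shift k)) (proj₁ (range-shift k))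
  g : Fin (hi ∸ lo) → Fin (hi' ∸ lo')
  g k = fromℕ< (g< k)
  g-injective : ∀ {k k'} → g k ≡ g k' → k ≡ k'
  g-injective {k} {k'} e = FP.toℕ-injective (+-cancelˡ-≡ lo (toℕ k) (toℕ k') (begin
    lo + toℕ k      ≡⟨ toℕ-shift k ⟨
    toℕ (shift k)   ≡⟨ cong toℕ (inj (∸-cancelʳ-≡ (proj₁ (range-shift k)) (proj₁ (range-shift k')) h-shift≡)) ⟩
    toℕ (shift k')  ≡⟨ toℕ-shift k' ⟩
    lo + toℕ k'     ∎))
    where
    open ≡-Reasoning
    h-shift≡ : h (shift k) ∸ lo' ≡ h (shift k') ∸ lo'
    h-shift≡ = trans (sym (FP.toℕ-fromℕ< (g< k))) (trans (cong toℕ e) (FP.toℕ-fromℕ< (g< k')))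

strictlyIncreasing-≤ : ∀ {n m} (e : Fin n → Fin m) → StrictlyIncreasing e → ∀ j k → toℕ j ≤ toℕ k → toℕ (e j) ≤ toℕ (e k)
strictlyIncreasing-≤ e inc j k j≤k with <-cmp (toℕ j) (toℕ k)
... | tri< j<k _ _ = <⇒≤ (inc j k j<k)
... | tri≈ _ j≡k _ = ≤-reflexive (cong (λ z → toℕ (e z)) (FP.toℕ-injective j≡k))
... | tri> _ _ k<j = ⊥-elim (<⇒≱ k<j j≤k)

strictlyIncreasing-injective : ∀ {n m} (e : Fin n → Fin m) → StrictlyIncreasing e → ∀ {j k} → toℕ (e j) ≡ toℕ (e k) → j ≡ k
strictlyIncreasing-injective e inc {j} {k} eq with <-cmp (toℕ j) (toℕ k)
... | tri< j<k _ _ = ⊥-elim (<⇒≢ (inc j k j<k) eq)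
... | tri≈ _ j≡k _ = FP.toℕ-injective j≡k
... | tri> _ _ k<j = ⊥-elim (>⇒≢ (inc k j k<j) eq)

-- Counting the positions below j and above j.
strictlyIncreasing-≥ : ∀ {n m} (e : Fin n → Fin m) → StrictlyIncreasing e → ∀ j → toℕ j ≤ toℕ (e j)
strictlyIncreasing-≥ e inc j =
  ≤-pred (injection-interval-≤ (λ x → toℕ (e x)) 0 (suc (toℕ j)) 0 (suc (toℕ (e j))) (FP.toℕ<n j)
    (λ x _ x≤j → z≤n , s≤s (strictlyIncreasing-≤ e inc x j (≤-pred x≤j)))
    (strictlyIncreasing-injective e inc))

strictlyIncreasing-≤-room : ∀ {n m} (e : Fin n → Fin m) → StrictlyIncreasing e → ∀ j → n ∸ toℕ j ≤ m ∸ toℕ (e j)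
strictlyIncreasing-≤-room {n} e inc j =
  injection-interval-≤ (λ x → toℕ (e x)) (toℕ j) n (toℕ (e j)) _ ≤-refl
    (λ x j≤x _ → strictlyIncreasing-≤ e inc j x j≤x , FP.toℕ<n (e x))
    (strictlyIncreasing-injective e inc)

strictlyIncreasing-endo-id : ∀ {n} (e : Fin n → Fin n) → StrictlyIncreasing e → ∀ j → e j ≡ j
strictlyIncreasing-endo-id {n} e inc j = FP.toℕ-injective (≤-antisym e≤ (strictlyIncreasing-≥ e inc j))
  where
  e≤ : toℕ (e j) ≤ toℕ j
  e≤ = ∸-cancelʳ-≤ (<⇒≤ (FP.toℕ<n (e j))) (strictlyIncreasing-≤-room e inc j)

sameOrder⇒≡ : ∀ {n} (σ τ : Perm n) → (∀ j k → (image σ j < image σ k) ⇔ (image τ j < image τ k)) → ∀ j → τ ⟨$⟩ʳ j ≡ σ ⟨$⟩ʳ j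
sameOrder⇒≡ σ τ iso j = begin
  τ ⟨$⟩ʳ j                    ≡⟨ cong (τ ⟨$⟩ʳ_) (inverseˡ σ) ⟨
  τ ⟨$⟩ʳ (σ ⟨$⟩ˡ (σ ⟨$⟩ʳ j))  ≡⟨ strictlyIncreasing-endo-id τσ⁻¹ τσ⁻¹-increasing (σ ⟨$⟩ʳ j) ⟩
  σ ⟨$⟩ʳ j                    ∎
  where
  open ≡-Reasoning
  τσ⁻¹ = λ v → τ ⟨$⟩ʳ (σ ⟨$⟩ˡ v)
  τσ⁻¹-increasing : StrictlyIncreasing τσ⁻¹
  τσ⁻¹-increasing v w lt = ⇔to (iso (σ ⟨$⟩ˡ v) (σ ⟨$⟩ˡ w)) (subst₂ _<_ (sym (cong toℕ (inverseʳ σ))) (sym (cong toℕ (inverseʳ σ))) lt)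

punchIn-mono-< : ∀ {n} (i : Fin (suc n)) (j k : Fin n) → toℕ j < toℕ k → toℕ (punchIn i j) < toℕ (punchIn i k)
punchIn-mono-< i j k lt = ≤∧≢⇒< (FP.punchIn-mono-≤ i j k (<⇒≤ lt))
  (λ e → <⇒≢ lt (cong toℕ (FP.punchIn-injective i j k (FP.toℕ-injective e))))

punchOut-mono-< : ∀ {n} {i j k : Fin (suc n)} (i≢j : i ≢ j) (i≢k : i ≢ k) → toℕ j < toℕ k → toℕ (punchOut i≢j) < toℕ (punchOut i≢k)
punchOut-mono-< i≢j i≢k lt = ≤∧≢⇒< (FP.punchOut-mono-≤ i≢j i≢k (<⇒≤ lt))
  (λ e → <⇒≢ lt (cong toℕ (FP.punchOut-injective i≢j i≢k (FP.toℕ-injective e))))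

Comp-remove : ∀ {n} {S : PermSet n} m (ρ : Perm (suc m)) → Comp (suc m) S ρ → ∀ x → Comp m S (remove x ρ)
Comp-remove m ρ C x τ (e , e-increasing , e-order) = C τ (punchIn x ∘ e , increasing , order)
  where
  increasing : StrictlyIncreasing (punchIn x ∘ e)
  increasing j k lt = punchIn-mono-< x (e j) (e k) (e-increasing j k lt)
  x≢ : ∀ j → image ρ x ≢ image ρ (punchIn x (e j))
  x≢ j = image-≢ ρ (λ eq → FP.punchInᵢ≢i x (e j) (sym eq))
  order : ∀ j k → (image ρ (punchIn x (e j)) < image ρ (punchIn x (e k))) ⇔ (image τ j < image τ k)
  order j k = mk⇔
    (λ lt → ⇔to (e-order j k) (remove-< x ρ (e j) (e k) lt))
    (λ lt → remove-<⁻ x ρ (e j) (e k) (⇔from (e-order j k) lt))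

Comp⇒member : ∀ {n} {S : PermSet n} (ρ : Perm n) → Comp n S ρ → S ρ
Comp⇒member ρ C = C ρ (id , (λ j k lt → lt) , (λ j k → mk⇔ id id))

Extensional : ∀ {n} → PermSet n → Set
Extensional {n} S = (ρ σ : Perm n) → (∀ x → ρ ⟨$⟩ʳ x ≡ σ ⟨$⟩ʳ x) → S ρ → S σ

member⇒Comp : ∀ {n} {S : PermSet n} → Extensional S → (ρ : Perm n) → S ρ → Comp n S ρ
member⇒Comp S-ext ρ Sρ τ (e , e-increasing , e-order) = S-ext ρ τ (λ j → sym (sameOrder⇒≡ ρ τ order j)) Sρ
  where
  e≡id = strictlyIncreasing-endo-id e e-increasing
  order : ∀ j k → (image ρ j < image ρ k) ⇔ (image τ j < image τ k)
  order j k = subst₂ (λ a b → (image ρ a < image ρ b) ⇔ (image τ j < image τ k)) (e≡id j) (e≡id k) (e-order j k)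

-- As n < suc m, an occurrence of τ in ρ misses some point x, and is an occurrence in remove x ρ.
remove-Comp⇒Comp : ∀ {n} {S : PermSet n} m → n ≤ m → (ρ : Perm (suc m)) → (∀ x → Comp m S (remove x ρ)) → Comp (suc m) S ρ
remove-Comp⇒Comp {n} m n≤m ρ C τ (e , e-increasing , e-order) with FP.all? (λ x → FP.any? (λ j → e j FP.≟ x))
... | yes e-onto = ⊥-elim (<⇒≱ (s≤s n≤m) (FP.injective⇒≤ {f = g} g-injective))
  where
  g : Fin (suc m) → Fin n
  g x = proj₁ (e-onto x)
  g-injective : ∀ {x y} → g x ≡ g y → x ≡ y
  g-injective {x} {y} eq = trans (sym (proj₂ (e-onto x))) (trans (cong e eq) (proj₂ (e-onto y)))
... | no e-not-onto with FP.¬∀⟶∃¬ (suc m) _ (λ x → FP.any? (λ j → e j FP.≟ x)) e-not-onto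
... | x , x∉e = C x τ (e' , increasing , order)
  where
  x≢ : ∀ j → x ≢ e j
  x≢ j eq = x∉e (j , sym eq)
  e' : Fin _ → Fin m
  e' j = punchOut (x≢ j)
  punchIn-e' : ∀ j → punchIn x (e' j) ≡ e j
  punchIn-e' j = FP.punchIn-punchOut (x≢ j)
  increasing : StrictlyIncreasing e'
  increasing j k lt = punchOut-mono-< (x≢ j) (x≢ k) (e-increasing j k lt)
  order : ∀ j k → (image (remove x ρ) (e' j) < image (remove x ρ) (e' k)) ⇔ (image τ j < image τ k)
  order j k = mk⇔
    (λ lt → ⇔to (e-order j k) (subst₂ (λ a b → image ρ a < image ρ b) (punchIn-e' j) (punchIn-e' k) (remove-<⁻ x ρ (e' j) (e' k) lt)))
    (λ lt → remove-< x ρ (e' j) (e' k) (subst₂ (λ a b → image ρ a < image ρ b) (sym (punchIn-e' j)) (sym (punchIn-e' k)) (⇔from (e-order j k) lt)))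

Comp-byRemoval : ∀ {n} {S : PermSet n} → Extensional S → (P : (m : ℕ) → Perm m → Set) →
  (∀ ρ → P n ρ → S ρ) →
  (∀ m ρ → n ≤ m → P (suc m) ρ → ∀ x → P m (remove x ρ)) →
  ∀ m → n ≤ m → (ρ : Perm m) → P m ρ → Comp m S ρ
Comp-byRemoval {n} S-ext P base step m n≤m ρ Pρ with m≤n⇒m<n∨m≡n n≤m
Comp-byRemoval {n} S-ext P base step m n≤m ρ Pρ | inj₂ refl = member⇒Comp S-ext ρ (base ρ Pρ)
Comp-byRemoval {n} S-ext P base step (suc m) n≤m ρ Pρ | inj₁ (s≤s n≤m') =
  remove-Comp⇒Comp m n≤m' ρ (λ x → Comp-byRemoval S-ext P base step m n≤m' (remove x ρ) (step m ρ n≤m' Pρ x))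

PreservesLabels : ∀ {n} → Partition n → Perm n → Set
PreservesLabels f ρ = ∀ j → f (ρ ⟨$⟩ʳ j) ≡ f j

S_Π⇒preservesLabels : ∀ {n} (f : Partition n) ρ → S_Π f ρ → PreservesLabels f ρ
S_Π⇒preservesLabels f ρ ρ∈S_Π j = proj₁ (ρ∈S_Π j) j refl

preservesLabels⇒S_Π : ∀ {n} (f : Partition n) ρ → PreservesLabels f ρ → S_Π f ρ
preservesLabels⇒S_Π f ρ pres b = (λ i eq → trans (pres i) eq) ,
  (λ j eq → (ρ ⟨$⟩ˡ j) , trans (trans (sym (pres (ρ ⟨$⟩ˡ j))) (cong f (inverseʳ ρ))) eq , inverseʳ ρ)

S_Π-extensional : ∀ {n} (f : Partition n) → Extensional (S_Π f)
S_Π-extensional f ρ σ ρ≗σ ρ∈S_Π = preservesLabels⇒S_Π f σ (λ j → trans (cong f (sym (ρ≗σ j))) (S_Π⇒preservesLabels f ρ ρ∈S_Π j))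

Comp-S_Π-byRemoval : ∀ {n} (f : Partition n) (P : (m : ℕ) → Perm m → Set) →
  (∀ ρ → P n ρ → PreservesLabels f ρ) →
  (∀ m ρ → n ≤ m → P (suc m) ρ → ∀ x → P m (remove x ρ)) →
  ∀ m → n ≤ m → (ρ : Perm m) → P m ρ → Comp m (S_Π f) ρ
Comp-S_Π-byRemoval f P base = Comp-byRemoval (S_Π-extensional f) P (λ ρ Pρ → preservesLabels⇒S_Π f ρ (base ρ Pρ))

Comp-extensional : ∀ {n} {S : PermSet n} m → Extensional (Comp m S)
Comp-extensional m ρ σ ρ≗σ C τ (e , e-increasing , e-order) =
  C τ (e , e-increasing , λ j k → subst₂ (λ a b → (toℕ a < toℕ b) ⇔ (image τ j < image τ k)) (sym (ρ≗σ (e j))) (sym (ρ≗σ (e k))) (e-order j k))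

SplitsAt : ∀ {k} → (Fin k → ℕ) → ℕ → Set
SplitsAt h s = ∀ x → (toℕ x < s → h x < s) × (s < toℕ x → s < h x) × (toℕ x ≡ s → h x ≡ s)

splitsAt-cong : ∀ {k} {h h' : Fin k → ℕ} {s} → (∀ x → h x ≡ h' x) → SplitsAt h s → SplitsAt h' s
splitsAt-cong {h = h} {h'} {s} h≗h' split x = subst (λ v → (toℕ x < s → v < s) × (s < toℕ x → s < v) × (toℕ x ≡ s → v ≡ s)) (h≗h' x) (split x)

-- Counting: [0, p) injects into [0, σ p) and (p, m] into (σ p, m].
splitsAt-fromOrder : ∀ {m} (σ : Perm (suc m)) (p : Fin (suc m)) →
  (∀ x → toℕ x < toℕ p → image σ x < image σ p) →
  (∀ x → toℕ p < toℕ x → image σ p < image σ x) →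
  SplitsAt (image σ) (toℕ p)
splitsAt-fromOrder {m} σ p low high x =
  (λ lt → subst (image σ x <_) y≡s (low x lt)) ,
  (λ gt → subst (_< image σ x) y≡s (high x gt)) ,
  (λ e → trans (cong (image σ) (FP.toℕ-injective e)) y≡s)
  where
  s = toℕ p
  y = image σ p
  s≤y : s ≤ y
  s≤y = injection-interval-≤ (image σ) 0 s 0 y (<⇒≤ (FP.toℕ<n p)) (λ x _ lt → z≤n , low x lt) (image-injective σ)
  room : suc m ∸ suc s ≤ suc m ∸ suc y
  room = injection-interval-≤ (image σ) (suc s) (suc m) (suc y) (suc m) ≤-refl (λ x gt _ → high x gt , image< σ x) (image-injective σ)
  y≡s : y ≡ s
  y≡s = ≤-antisym (∸-cancelʳ-≤ (≤-pred (image< σ p)) room) s≤y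

-- Every deletion preserves G and G (s − 1) ≢ G s: this puts the points left of s on one side of
-- ρ s and those right of s on the other; comparing ρ 0 with ρ m tells which side is which.
module BoundarySplit {m} {A : Set} (G : ℕ → A) (ρ : Perm (suc m)) (pres : ∀ x → Preserves G (remove x ρ))
                     (s : ℕ) (1≤s : 1 ≤ s) (s<m : s < m) (G≢ : G (s ∸ 1) ≢ G s) where

  p : Fin (suc m)
  p = fromℕ< (m<n⇒m<1+n s<m)

  toℕ-p : toℕ p ≡ s
  toℕ-p = FP.toℕ-fromℕ< (m<n⇒m<1+n s<m)

  y = image ρ p
  first = image ρ F.zero
  last = image ρ (fromℕ m)

  label-low : ∀ x → toℕ x < s → G (punchOutℕ (image ρ x) y) ≡ G (s ∸ 1)
  label-low x x<s = trans (preserves-remove G ρ x p (pres x) (λ e → <⇒≢ x<s (trans (cong toℕ e) toℕ-p)))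
                          (cong G (trans (cong (punchOutℕ (toℕ x)) toℕ-p) (punchOutℕ-< x<s)))

  label-high : ∀ x → s < toℕ x → G (punchOutℕ (image ρ x) y) ≡ G s
  label-high x s<x = trans (preserves-remove G ρ x p (pres x) (λ e → >⇒≢ s<x (trans (cong toℕ e) toℕ-p)))
                           (cong G (trans (cong (punchOutℕ (toℕ x)) toℕ-p) (punchOutℕ-≥ (<⇒≤ s<x))))

  label-first : G (punchOutℕ first y) ≡ G (s ∸ 1)
  label-first = label-low F.zero 1≤s

  label-last : G (punchOutℕ last y) ≡ G s
  label-last = label-high (fromℕ m) (subst (s <_) (sym (FP.toℕ-fromℕ m)) s<m)

  ≢p : ∀ x → toℕ x ≢ s → image ρ x ≢ y
  ≢p x x≢s e = x≢s (trans (cong toℕ (image-injective ρ e)) toℕ-p)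

  below : ∀ x → toℕ x ≢ s → G (punchOutℕ (image ρ x) y) ≢ G y → image ρ x < y
  below x x≢s ≢Gy with <-cmp (image ρ x) y
  ... | tri< lt _ _ = lt
  ... | tri≈ _ e _ = ⊥-elim (≢p x x≢s e)
  ... | tri> _ _ gt = ⊥-elim (≢Gy (cong G (punchOutℕ-≥ (<⇒≤ gt))))

  above : ∀ x → toℕ x ≢ s → G (punchOutℕ (image ρ x) y) ≢ G (y ∸ 1) → y < image ρ x
  above x x≢s ≢Gy-1 with <-cmp (image ρ x) y
  ... | tri< lt _ _ = ⊥-elim (≢Gy-1 (cong G (punchOutℕ-< lt)))
  ... | tri≈ _ e _ = ⊥-elim (≢p x x≢s e)
  ... | tri> _ _ gt = gt

  ascending : first < last → SplitsAt (image ρ) s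
  ascending first<last = subst (SplitsAt (image ρ)) toℕ-p
    (splitsAt-fromOrder ρ p (λ x lt → low x (subst (toℕ x <_) toℕ-p lt))
                            (λ x gt → high x (subst (_< toℕ x) toℕ-p gt)))
    where
    first<y : first < y
    first<y with <-cmp first y
    ... | tri< lt _ _ = lt
    ... | tri≈ _ e _ = ⊥-elim (≢p F.zero (<⇒≢ 1≤s) e)
    ... | tri> _ _ y<first = ⊥-elim (G≢ (begin
      G (s ∸ 1)               ≡⟨ label-first ⟨
      G (punchOutℕ first y)   ≡⟨ cong G (trans (punchOutℕ-≥ (<⇒≤ y<first)) (sym (punchOutℕ-≥ (<⇒≤ (<-trans y<first first<last))))) ⟩
      G (punchOutℕ last y)    ≡⟨ label-last ⟩
      G s                     ∎))
      where open ≡-Reasoning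
    G[y∸1]≡G[s∸1] : G (y ∸ 1) ≡ G (s ∸ 1)
    G[y∸1]≡G[s∸1] = trans (cong G (sym (punchOutℕ-< first<y))) label-first
    high : ∀ x → s < toℕ x → y < image ρ x
    high x s<x = above x (>⇒≢ s<x) (λ e → G≢ (trans (sym G[y∸1]≡G[s∸1]) (trans (sym e) (label-high x s<x))))
    G[y]≡G[s] : G y ≡ G s
    G[y]≡G[s] = trans (cong G (sym (punchOutℕ-≥ (<⇒≤ (high (fromℕ m) (subst (s <_) (sym (FP.toℕ-fromℕ m)) s<m)))))) label-last
    low : ∀ x → toℕ x < s → image ρ x < y
    low x x<s = below x (<⇒≢ x<s) (λ e → G≢ (trans (sym (label-low x x<s)) (trans e G[y]≡G[s])))

  descending : last < first → SplitsAt (image (ρ ∘ₚ reverse)) s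
  descending last<first = subst (SplitsAt (image (ρ ∘ₚ reverse))) toℕ-p
    (splitsAt-fromOrder (ρ ∘ₚ reverse) p (λ x lt → opposite-< (ρ ⟨$⟩ʳ p) (ρ ⟨$⟩ʳ x) (low x (subst (toℕ x <_) toℕ-p lt)))
                                         (λ x gt → opposite-< (ρ ⟨$⟩ʳ x) (ρ ⟨$⟩ʳ p) (high x (subst (_< toℕ x) toℕ-p gt))))
    where
    y<first : y < first
    y<first with <-cmp y first
    ... | tri< lt _ _ = lt
    ... | tri≈ _ e _ = ⊥-elim (≢p F.zero (<⇒≢ 1≤s) (sym e))
    ... | tri> _ _ first<y = ⊥-elim (G≢ (begin
      G (s ∸ 1)               ≡⟨ label-first ⟨
      G (punchOutℕ first y)   ≡⟨ cong G (trans (punchOutℕ-< first<y) (sym (punchOutℕ-< (<-trans last<first first<y)))) ⟩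
      G (punchOutℕ last y)    ≡⟨ label-last ⟩
      G s                     ∎))
      where open ≡-Reasoning
    G[y]≡G[s∸1] : G y ≡ G (s ∸ 1)
    G[y]≡G[s∸1] = trans (cong G (sym (punchOutℕ-≥ (<⇒≤ y<first)))) label-first
    high : ∀ x → s < toℕ x → image ρ x < y
    high x s<x = below x (>⇒≢ s<x) (λ e → G≢ (trans (sym G[y]≡G[s∸1]) (trans (sym e) (label-high x s<x))))
    G[y∸1]≡G[s] : G (y ∸ 1) ≡ G s
    G[y∸1]≡G[s] = trans (cong G (sym (punchOutℕ-< (high (fromℕ m) (subst (s <_) (sym (FP.toℕ-fromℕ m)) s<m))))) label-last
    low : ∀ x → toℕ x < s → y < image ρ x
    low x x<s = above x (<⇒≢ x<s) (λ e → G≢ (trans (sym (label-low x x<s)) (trans e G[y∸1]≡G[s])))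

-- label extends the labelling f to all of ℕ (junk value 0 outside [0, n)); a boundary
-- is a position s where a new block of Π̂ starts.
module Boundaries {n : ℕ} (f : Partition n) where

  label : ℕ → ℕ
  label k with k <? n
  ... | yes k<n = f (fromℕ< k<n)
  ... | no _ = 0

  label-toℕ : ∀ j → label (toℕ j) ≡ f j
  label-toℕ j with toℕ j <? n
  ... | yes j<n = cong f (FP.fromℕ<-toℕ j j<n)
  ... | no j≮n = ⊥-elim (j≮n (FP.toℕ<n j))

  preservesLabels⇒Preserves : ∀ (ρ : Perm n) → PreservesLabels f ρ → Preserves label ρ
  preservesLabels⇒Preserves ρ pres j = trans (label-toℕ (ρ ⟨$⟩ʳ j)) (trans (pres j) (sym (label-toℕ j)))

  Comp-remove⇒preserves : (ρ : Perm (suc n)) → Comp (suc n) (S_Π f) ρ → ∀ x → Preserves label (remove x ρ)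
  Comp-remove⇒preserves ρ C x =
    preservesLabels⇒Preserves (remove x ρ) (S_Π⇒preservesLabels f (remove x ρ) (Comp⇒member (remove x ρ) (Comp-remove n ρ C x)))

  Boundary : ℕ → Set
  Boundary s = (1 ≤ s) × (s < n) × (label (s ∸ 1) ≢ label s)

  boundary? : ∀ s → Dec (Boundary s)
  boundary? s = (1 ≤? s) ×-dec ((s <? n) ×-dec ¬? (label (s ∸ 1) Data.Nat.≟ label s))

  -- w lies in the first i positions of a block of Π̂ that is not the first one.
  Near : ℕ → ℕ → Set
  Near i w = Σ ℕ λ b → Boundary b × b ≤ w × w < b + i

  near? : ∀ i w → Dec (Near i w)
  near? i w with anyUpTo? (λ b → boundary? b ×-dec (w <? b + i)) (suc w)
  ... | yes (b , b≤w , bd , w<) = yes (b , bd , ≤-pred b≤w , w<)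
  ... | no ¬near = no (λ { (b , bd , b≤w , w<) → ¬near (b , s≤s b≤w , bd , w<) })

  near-≥1 : ∀ {i w} → Near i w → 1 ≤ w
  near-≥1 (b , bd , b≤w , _) = ≤-trans (proj₁ bd) b≤w

  near-< : ∀ {i w} → Near i w → suc w < n + i
  near-< {i} (b , bd , _ , w<) = ≤-trans (s≤s w<) (+-monoˡ-≤ i (proj₁ (proj₂ bd)))

  -- One plus the last position below p that is Near i (0 if there is none).
  lastNear : ℕ → ℕ → ℕ
  lastNear i zero = zero
  lastNear i (suc p) with near? i p
  ... | yes _ = suc p
  ... | no _ = lastNear i p

  -- Positions Near i get their own labels; the others are labelled by the last
  -- preceding Near i position, so every position Near (suc i) is a boundary.
  relabel : ℕ → ℕ → ℕ ⊎ ℕ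
  relabel i p with near? i p
  ... | yes _ = inj₁ p
  ... | no _ = inj₂ (lastNear i p)

  relabel-near : ∀ {i p} → Near i p → relabel i p ≡ inj₁ p
  relabel-near {i} {p} near with near? i p
  ... | yes _ = refl
  ... | no ¬near = ⊥-elim (¬near near)

  relabel-far : ∀ {i p} → ¬ Near i p → relabel i p ≡ inj₂ (lastNear i p)
  relabel-far {i} {p} ¬near with near? i p
  ... | yes near = ⊥-elim (¬near near)
  ... | no _ = refl

  LastNearSpec : ℕ → ℕ → Set
  LastNearSpec i p = (lastNear i p ≡ 0 × (∀ w → Near i w → ¬ w < p)) ⊎
                     (Σ ℕ λ w → lastNear i p ≡ suc w × Near i w × w < p × (∀ w' → Near i w' → w' < p → w' ≤ w))

  lastNear-spec : ∀ i p → LastNearSpec i p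
  lastNear-spec i zero = inj₁ (refl , λ _ _ ())
  lastNear-spec i (suc p) with near? i p | lastNear-spec i p
  ... | yes near | _ = inj₂ (p , refl , near , ≤-refl , λ w' _ lt → ≤-pred lt)
  ... | no ¬near | inj₁ (e , none) = inj₁ (e , λ w near-w w<sp → noneAt w near-w (≤-pred w<sp))
    where
    noneAt : ∀ w → Near i w → w ≤ p → ⊥
    noneAt w near-w w≤p with m≤n⇒m<n∨m≡n w≤p
    ... | inj₁ w<p = none w near-w w<p
    ... | inj₂ refl = ¬near near-w
  ... | no ¬near | inj₂ (w , e , near-w , w<p , greatest) = inj₂ (w , e , near-w , m<n⇒m<1+n w<p , greatest')
    where
    greatest' : ∀ w' → Near i w' → w' < suc p → w' ≤ w
    greatest' w' near-w' w'<sp with m≤n⇒m<n∨m≡n (≤-pred w'<sp)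
    ... | inj₁ w'<p = greatest w' near-w' w'<p
    ... | inj₂ refl = ⊥-elim (¬near near-w')

  lastNear-cong : ∀ i p q → (∀ w → Near i w → (w < p → w < q) × (w < q → w < p)) → lastNear i p ≡ lastNear i q
  lastNear-cong i p q same with lastNear-spec i p | lastNear-spec i q
  ... | inj₁ (e , _) | inj₁ (e' , _) = trans e (sym e')
  ... | inj₁ (_ , none) | inj₂ (w , _ , near-w , w<q , _) = ⊥-elim (none w near-w (proj₂ (same w near-w) w<q))
  ... | inj₂ (w , _ , near-w , w<p , _) | inj₁ (_ , none) = ⊥-elim (none w near-w (proj₁ (same w near-w) w<p))
  ... | inj₂ (w , e , near-w , w<p , greatest) | inj₂ (w' , e' , near-w' , w'<q , greatest') =
        trans e (trans (cong suc (≤-antisym (greatest' w near-w (proj₁ (same w near-w) w<p))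
                                            (greatest w' near-w' (proj₂ (same w' near-w') w'<q)))) (sym e'))

  SplitsNear : ∀ {m} → ℕ → (Fin m → ℕ) → Set
  SplitsNear i h = ∀ w → Near i w → SplitsAt h w

  splitsNear⇒preserves : ∀ {m} i (ρ : Perm m) → SplitsNear i (image ρ) → Preserves (relabel i) ρ
  splitsNear⇒preserves i ρ split x = byNear (near? i (toℕ x))
    where
    byNear : Dec (Near i (toℕ x)) → relabel i (image ρ x) ≡ relabel i (toℕ x)
    byNear (yes near-x) = cong (relabel i) (proj₂ (proj₂ (split (toℕ x) near-x x)) refl)
    byNear (no ¬near-x) = trans (relabel-far ¬near-ρx) (trans (cong inj₂ (lastNear-cong i (image ρ x) (toℕ x) same)) (sym (relabel-far ¬near-x)))
      where
      ¬near-ρx : ¬ Near i (image ρ x)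
      ¬near-ρx near with <-cmp (toℕ x) (image ρ x)
      ... | tri< lt _ _ = <-irrefl refl (proj₁ (split (image ρ x) near x) lt)
      ... | tri≈ _ e _ = ¬near-x (subst (Near i) (sym e) near)
      ... | tri> _ _ gt = <-irrefl refl (proj₁ (proj₂ (split (image ρ x) near x)) gt)
      same : ∀ w → Near i w → (w < image ρ x → w < toℕ x) × (w < toℕ x → w < image ρ x)
      same w near-w = back , proj₁ (proj₂ (split w near-w x))
        where
        back : w < image ρ x → w < toℕ x
        back lt with <-cmp (toℕ x) w
        ... | tri< x<w _ _ = ⊥-elim (<-asym lt (proj₁ (split w near-w x) x<w))
        ... | tri≈ _ e _ = ⊥-elim (¬near-x (subst (Near i) (sym e) near-w))
        ... | tri> _ _ w<x = w<x

  relabel-boundary : ∀ i → 1 ≤ i → ∀ s → Near (suc i) s → relabel i (s ∸ 1) ≢ relabel i s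
  relabel-boundary i 1≤i s (b , bd , b≤s , s<) = byNear (near? i s) (near? i (s ∸ 1))
    where
    1≤s = ≤-trans (proj₁ bd) b≤s
    inj₁≢inj₂ : ∀ {a c : ℕ} → inj₁ {B = ℕ} a ≢ inj₂ c
    inj₁≢inj₂ ()
    byNear : Dec (Near i s) → Dec (Near i (s ∸ 1)) → relabel i (s ∸ 1) ≢ relabel i s
    byNear (yes near-s) (yes near-s-1) e =
      <⇒≢ (≤-reflexive (suc-∸1 1≤s)) (inj₁-injective (trans (sym (relabel-near near-s-1)) (trans e (relabel-near near-s))))
    byNear (yes near-s) (no ¬near-s-1) e = inj₁≢inj₂ (trans (sym (relabel-near near-s)) (trans (sym e) (relabel-far ¬near-s-1)))
    byNear (no ¬near-s) _ e = inj₁≢inj₂ (trans (sym (relabel-near near-s-1)) (trans e (relabel-far ¬near-s)))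
      where
      b+i≤s : b + i ≤ s
      b+i≤s = ≮⇒≥ (λ s<b+i → ¬near-s (b , bd , b≤s , s<b+i))
      near-s-1 : Near i (s ∸ 1)
      near-s-1 = b , bd , ≤pred (subst (_≤ s) (+-comm b 1) (≤-trans (+-monoʳ-≤ b 1≤i) b+i≤s))
                     , <-≤-trans (≤-reflexive (suc-∸1 1≤s)) (≤-pred (subst (s <_) (+-suc b i) s<))

  label-constant : ∀ u v → u ≤ v → v < n → (∀ b → Boundary b → u < b → v < b) → label u ≡ label v
  label-constant u zero u≤0 _ _ = cong label (n≤0⇒n≡0 u≤0)
  label-constant u (suc v) u≤v+1 v+1<n none with m≤n⇒m<n∨m≡n u≤v+1
  ... | inj₂ refl = refl
  ... | inj₁ u<v+1 = trans (label-constant u v (≤-pred u<v+1) (<-trans (n<1+n v) v+1<n) (λ b bd u<b → <-trans (n<1+n v) (none b bd u<b))) step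
    where
    step : label v ≡ label (suc v)
    step with label v Data.Nat.≟ label (suc v)
    ... | yes e = e
    ... | no ne = ⊥-elim (<-irrefl refl (none (suc v) (s≤s z≤n , v+1<n , ne) u<v+1))

  sameBoundaries⇒label-≡ : ∀ u v → u < n → v < n → (∀ b → Boundary b → (b ≤ u → b ≤ v) × (b ≤ v → b ≤ u)) → label u ≡ label v
  sameBoundaries⇒label-≡ u v u<n v<n same with ≤-total u v
  ... | inj₁ u≤v = label-constant u v u≤v v<n (λ b bd u<b → ≰⇒> (λ b≤v → <⇒≱ u<b (proj₂ (same b bd) b≤v)))
  ... | inj₂ v≤u = sym (label-constant v u v≤u u<n (λ b bd v<b → ≰⇒> (λ b≤u → <⇒≱ v<b (proj₁ (same b bd) b≤u))))

  twoBlocks⇒boundary : AtLeastTwoBlocks f → Σ ℕ Boundary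
  twoBlocks⇒boundary (i , j , fi≢fj) with anyUpTo? boundary? n
  ... | yes (b , _ , bd) = b , bd
  ... | no none = ⊥-elim (fi≢fj (ordered (≤-total (toℕ i) (toℕ j))))
    where
    noBoundary : ∀ {u v : ℕ} b → Boundary b → u < b → v < b
    noBoundary b bd _ = ⊥-elim (none (b , proj₁ (proj₂ bd) , bd))
    ordered : toℕ i ≤ toℕ j ⊎ toℕ j ≤ toℕ i → f i ≡ f j
    ordered (inj₁ i≤j) = trans (sym (label-toℕ i)) (trans (label-constant (toℕ i) (toℕ j) i≤j (FP.toℕ<n j) noBoundary) (label-toℕ j))
    ordered (inj₂ j≤i) = sym (trans (sym (label-toℕ j)) (trans (label-constant (toℕ j) (toℕ i) j≤i (FP.toℕ<n i) noBoundary) (label-toℕ i)))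

Ascending : ∀ {m} → Perm (suc m) → Set
Ascending {m} ρ = image ρ F.zero < image ρ (fromℕ m)

Descending : ∀ {m} → Perm (suc m) → Set
Descending {m} ρ = image ρ (fromℕ m) < image ρ F.zero

punchIn-first : ∀ {m} (x : Fin (suc (suc m))) → 1 ≤ toℕ x → punchIn x F.zero ≡ F.zero
punchIn-first (F.suc x) _ = refl

punchIn-last : ∀ {m} (x : Fin (suc (suc m))) → toℕ x ≤ m → punchIn x (fromℕ m) ≡ fromℕ (suc m)
punchIn-last {m} x x≤ = FP.toℕ-injective (trans (toℕ-punchIn-≥ x (fromℕ m) (subst (toℕ x ≤_) (sym (FP.toℕ-fromℕ m)) x≤))
                                                 (trans (cong suc (FP.toℕ-fromℕ m)) (sym (FP.toℕ-fromℕ (suc m)))))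

module _ {m} (ρ : Perm (suc (suc m))) (x : Fin (suc (suc m))) (1≤x : 1 ≤ toℕ x) (x≤ : toℕ x ≤ m) where

  remove-inner-ascending : Ascending ρ → Ascending (remove x ρ)
  remove-inner-ascending asc = remove-< x ρ F.zero (fromℕ m)
    (subst₂ (λ a b → image ρ a < image ρ b) (sym (punchIn-first x 1≤x)) (sym (punchIn-last x x≤)) asc)

  remove-inner-descending : Descending ρ → Descending (remove x ρ)
  remove-inner-descending desc = remove-< x ρ (fromℕ m) F.zero
    (subst₂ (λ a b → image ρ a < image ρ b) (sym (punchIn-last x x≤)) (sym (punchIn-first x 1≤x)) desc)

splitsAt-< : ∀ {m} (h : Fin m → ℕ) w → SplitsAt h w → ∀ p q → toℕ p ≤ w → w ≤ toℕ q → toℕ p < toℕ q → h p < h q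
splitsAt-< h w split p q p≤w w≤q p<q with m≤n⇒m<n∨m≡n p≤w | m≤n⇒m<n∨m≡n w≤q
... | inj₁ p<w | inj₁ w<q = <-trans (proj₁ (split p) p<w) (proj₁ (proj₂ (split q)) w<q)
... | inj₁ p<w | inj₂ w≡q = subst (h p <_) (sym (proj₂ (proj₂ (split q)) (sym w≡q))) (proj₁ (split p) p<w)
... | inj₂ p≡w | inj₁ w<q = subst (_< h q) (sym (proj₂ (proj₂ (split p)) p≡w)) (proj₁ (proj₂ (split q)) w<q)
... | inj₂ p≡w | inj₂ w≡q = ⊥-elim (<-irrefl (trans p≡w w≡q) p<q)

module AscendingSplits {n : ℕ} (f : Partition n) (2≤n : 2 ≤ n) (b₀ : Σ ℕ (Boundaries.Boundary f)) where
  open Boundaries f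

  b0 = proj₁ b₀
  boundary-b0 = proj₂ b₀

  near-b0 : ∀ i → Near (suc i) b0
  near-b0 i = b0 , boundary-b0 , ≤-refl , subst (b0 <_) (sym (+-suc b0 i)) (s≤s (m≤m+n b0 i))

  near₁⇒boundary : ∀ {w} → Near 1 w → Boundary w
  near₁⇒boundary {w} (b , bd , b≤w , w<b+1) = subst Boundary (≤-antisym b≤w (≤-pred (subst (w <_) (+-comm b 1) w<b+1))) bd

  -- Deleting an inner point keeps ρ ascending; for the two end points one compares ρ 1
  -- with the last and ρ 0 with the last-but-one point, which the split at b0 provides.
  module _ (d : ℕ) (ρ : Perm (suc (suc (d + n)))) (asc : Ascending ρ)
           (split : ∀ x → Ascending (remove x ρ) → SplitsAt (image (remove x ρ)) b0) where
    private
      2≤d+n : 2 ≤ d + n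
      2≤d+n = ≤-trans 2≤n (m≤n+m n d)
      1≤d+n : 1 ≤ d + n
      1≤d+n = ≤-trans (s≤s z≤n) 2≤d+n
      b0<d+n : b0 < d + n
      b0<d+n = <-≤-trans (proj₁ (proj₂ boundary-b0)) (m≤n+m n d)
      one : ∀ {k} → Fin (suc (suc k))
      one = F.suc F.zero
      penultimate : Fin (suc (suc (d + n)))
      penultimate = inject₁ (fromℕ (d + n))
      toℕ-penultimate : toℕ penultimate ≡ d + n
      toℕ-penultimate = trans (FP.toℕ-inject₁ (fromℕ (d + n))) (FP.toℕ-fromℕ (d + n))
      toℕ-last : toℕ (fromℕ (d + n)) ≡ d + n
      toℕ-last = FP.toℕ-fromℕ (d + n)

      ρ1<ρ[last] : image ρ one < image ρ (fromℕ (suc (d + n)))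
      ρ1<ρ[last] = subst₂ (λ a b → image ρ a < image ρ b) punchIn-one (punchIn-last penultimate (≤-reflexive toℕ-penultimate))
                     (remove-<⁻ penultimate ρ one′ (fromℕ (d + n)) σ1<σ[last])
        where
        one′ : Fin (suc (d + n))
        one′ = fromℕ< (s≤s 1≤d+n)
        toℕ-one′ : toℕ one′ ≡ 1
        toℕ-one′ = FP.toℕ-fromℕ< (s≤s 1≤d+n)
        punchIn-one : punchIn penultimate one′ ≡ one
        punchIn-one = FP.toℕ-injective (trans (toℕ-punchIn-< penultimate one′ (subst₂ _<_ (sym toℕ-one′) (sym toℕ-penultimate) 2≤d+n)) toℕ-one′)
        σ = remove penultimate ρ
        σ1<σ[last] : image σ one′ < image σ (fromℕ (d + n))
        σ1<σ[last] = splitsAt-< (image σ) b0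
          (split penultimate (remove-inner-ascending ρ penultimate (subst (1 ≤_) (sym toℕ-penultimate) 1≤d+n) (≤-reflexive toℕ-penultimate) asc))
          one′ (fromℕ (d + n)) (subst (_≤ b0) (sym toℕ-one′) (proj₁ boundary-b0)) (subst (b0 ≤_) (sym toℕ-last) (<⇒≤ b0<d+n))
          (subst₂ _<_ (sym toℕ-one′) (sym toℕ-last) 2≤d+n)

      ρ0<ρ[last-1] : image ρ F.zero < image ρ penultimate
      ρ0<ρ[last-1] = subst (λ b → image ρ F.zero < image ρ b) punchIn-q (remove-<⁻ one ρ F.zero q σ0<σq)
        where
        q : Fin (suc (d + n))
        q = fromℕ< (s≤s (m∸n≤m (d + n) 1))
        toℕ-q : toℕ q ≡ d + n ∸ 1
        toℕ-q = FP.toℕ-fromℕ< (s≤s (m∸n≤m (d + n) 1))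
        punchIn-q : punchIn one q ≡ penultimate
        punchIn-q = FP.toℕ-injective (trans (toℕ-punchIn-≥ one q (subst (1 ≤_) (sym toℕ-q) (≤pred 2≤d+n)))
                                            (trans (cong suc toℕ-q) (trans (suc-∸1 1≤d+n) (sym toℕ-penultimate))))
        σ = remove one ρ
        σ0<σq : image σ F.zero < image σ q
        σ0<σq = splitsAt-< (image σ) b0 (split one (remove-inner-ascending ρ one ≤-refl 1≤d+n asc))
          F.zero q z≤n (subst (b0 ≤_) (sym toℕ-q) (≤pred b0<d+n)) (subst (0 <_) (sym toℕ-q) (≤pred 2≤d+n))

    remove-ascending : ∀ x → Ascending (remove x ρ)
    remove-ascending x with toℕ x Data.Nat.≟ 0 | toℕ x Data.Nat.≟ suc (d + n)
    ... | yes x≡0 | _ = subst (λ x → Ascending (remove x ρ)) (FP.toℕ-injective (sym x≡0)) (remove-< F.zero ρ F.zero (fromℕ (d + n)) ρ1<ρ[last])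
    ... | no x≢0 | yes x≡last = remove-< x ρ F.zero (fromℕ (d + n))
      (subst₂ (λ a b → image ρ a < image ρ b) (sym (punchIn-first x (≤∧≢⇒< z≤n (x≢0 ∘ sym)))) (sym punchIn-x) ρ0<ρ[last-1])
      where
      punchIn-x : punchIn x (fromℕ (d + n)) ≡ penultimate
      punchIn-x = FP.toℕ-injective (trans (toℕ-punchIn-< x (fromℕ (d + n)) (subst₂ _<_ (sym toℕ-last) (sym x≡last) ≤-refl))
                                          (trans toℕ-last (sym toℕ-penultimate)))
    ... | no x≢0 | no x≢last = remove-inner-ascending ρ x (≤∧≢⇒< z≤n (x≢0 ∘ sym)) (≤-pred (≤∧≢⇒< (≤-pred (FP.toℕ<n x)) x≢last)) asc

  -- The deletions of ρ split at every point Near (suc d), hence preserve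
  -- relabel (suc d), whose boundaries include every point Near (suc (suc d)).
  Comp-ascending⇒splitsNear : ∀ d (ρ : Perm (suc (d + n))) → Comp (suc (d + n)) (S_Π f) ρ →
    Ascending ρ → SplitsNear (suc d) (image ρ)
  Comp-ascending⇒splitsNear zero ρ C asc w near-w =
    BoundarySplit.ascending label ρ (Comp-remove⇒preserves ρ C) w (proj₁ bd) (proj₁ (proj₂ bd)) (proj₂ (proj₂ bd)) asc
    where
    bd = near₁⇒boundary near-w
  Comp-ascending⇒splitsNear (suc d) ρ C asc w near-w =
    BoundarySplit.ascending (relabel (suc d)) ρ pres w (near-≥1 near-w) w<last (relabel-boundary (suc d) (s≤s z≤n) w near-w) asc
    where
    IH : ∀ x → Ascending (remove x ρ) → SplitsNear (suc d) (image (remove x ρ))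
    IH x = Comp-ascending⇒splitsNear d (remove x ρ) (Comp-remove (suc (d + n)) ρ C x)
    pres : ∀ x → Preserves (relabel (suc d)) (remove x ρ)
    pres x = splitsNear⇒preserves (suc d) (remove x ρ) (IH x (remove-ascending d ρ asc (λ x' asc' → IH x' asc' b0 (near-b0 d)) x))
    w<last : w < suc (d + n)
    w<last = ≤-pred (subst (suc w <_) (+-comm n (suc (suc d))) (near-< near-w))

Palindromic : ∀ {n} → Partition n → Set
Palindromic {n} f = ∀ j → f (opposite j) ≡ f j

module Reversal {n : ℕ} (f : Partition n) where
  open Boundaries f

  palindromic-fromℕ : (∀ v → v < n → label (n ∸ 1 ∸ v) ≡ label v) → Palindromic f
  palindromic-fromℕ sym-label j = begin
    f (opposite j)                   ≡⟨ label-toℕ (opposite j) ⟨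
    label (toℕ (opposite j))         ≡⟨ cong label (trans (FP.opposite-prop j) (sym (∸-+-assoc n 1 (toℕ j)))) ⟩
    label (n ∸ 1 ∸ toℕ j)            ≡⟨ sym-label (toℕ j) (FP.toℕ<n j) ⟩
    label (toℕ j)                    ≡⟨ label-toℕ j ⟩
    f j                              ∎
    where open ≡-Reasoning

  -- If ρ ∈ Comp_{n+1}(S_Π) is descending, then ρ with reversed values splits at every
  -- boundary, so j and n-1-τ(j) lie in the same block of Π̂, where τ = remove 0 ρ ∈ S_Π.
  Comp-descending⇒palindromic₀ : (ρ : Perm (suc n)) → Comp (suc n) (S_Π f) ρ → Descending ρ → Palindromic f
  Comp-descending⇒palindromic₀ ρ C desc = palindromic-fromℕ label-symmetric
    where
    pres = Comp-remove⇒preserves ρ C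
    reversed : Fin (suc n) → ℕ
    reversed x = n ∸ image ρ x
    reversed-splits : ∀ b → Boundary b → SplitsAt reversed b
    reversed-splits b bd = splitsAt-cong (λ x → FP.opposite-prop (ρ ⟨$⟩ʳ x))
      (BoundarySplit.descending label ρ pres b (proj₁ bd) (proj₁ (proj₂ bd)) (proj₂ (proj₂ bd)) desc)
    reversed-first< : ∀ b → Boundary b → reversed F.zero < b
    reversed-first< b bd = proj₁ (reversed-splits b bd F.zero) (proj₁ bd)
    image≤ : ∀ x → image ρ x ≤ n
    image≤ x = ≤-pred (image< ρ x)
    τ = remove F.zero ρ
    label-reversed : ∀ j → label (n ∸ 1 ∸ image τ j) ≡ label (toℕ j)
    label-reversed j = sym (sameBoundaries⇒label-≡ (toℕ j) (n ∸ 1 ∸ image τ j) (FP.toℕ<n j) bound same)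
      where
      p = F.suc j
      first≢ : image ρ F.zero ≢ image ρ p
      first≢ = image-≢ ρ (λ ())
      bound : n ∸ 1 ∸ image τ j < n
      bound = ≤-trans (s≤s (m∸n≤m (n ∸ 1) (image τ j))) (≤-reflexive (suc-∸1 (≤-trans (s≤s z≤n) (FP.toℕ<n j))))
      reversed-τ : n ∸ 1 ∸ image τ j ≡ punchOutℕ (reversed F.zero) (reversed p)
      reversed-τ = trans (cong (λ z → n ∸ 1 ∸ z) (image-remove F.zero ρ j)) (punchOutℕ-complement (image≤ F.zero) (image≤ p) first≢)
      same : ∀ b → Boundary b → (b ≤ toℕ j → b ≤ n ∸ 1 ∸ image τ j) × (b ≤ n ∸ 1 ∸ image τ j → b ≤ toℕ j)
      same b bd = (λ b≤j → subst (b ≤_) (sym reversed-τ) (fwd b≤j)) , (λ le → bwd (subst (b ≤_) reversed-τ le))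
        where
        split = reversed-splits b bd
        fwd : b ≤ toℕ j → b ≤ punchOutℕ (reversed F.zero) (reversed p)
        fwd b≤j = subst (b ≤_) (sym (punchOutℕ-< (<-trans (reversed-first< b bd) b<)) ) (≤pred b<)
          where
          b< = proj₁ (proj₂ (split p)) (s≤s b≤j)
        bwd : b ≤ punchOutℕ (reversed F.zero) (reversed p) → b ≤ toℕ j
        bwd le with <-cmp (reversed F.zero) (reversed p)
        ... | tri< r0<rp _ _ = ≤-pred (b<p (subst (b ≤_) (punchOutℕ-< r0<rp) le))
          where
          b<p : b ≤ reversed p ∸ 1 → b < suc (toℕ j)
          b<p b≤ with <-cmp (toℕ p) b
          ... | tri< p<b _ _ = ⊥-elim (<⇒≱ (proj₁ (split p) p<b) (≤-trans b≤ (m∸n≤m (reversed p) 1)))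
          ... | tri≈ _ p≡b _ = ⊥-elim (<-irrefl refl (≤-<-trans (subst (λ r → b ≤ r ∸ 1) (proj₂ (proj₂ (split p)) p≡b) b≤) (≤-reflexive (suc-∸1 (proj₁ bd)))))
          ... | tri> _ _ b<p = b<p
        ... | tri≈ _ e _ = ⊥-elim (first≢ (∸-cancelˡ-≡ (image≤ F.zero) (image≤ p) e))
        ... | tri> _ _ rp<r0 = ⊥-elim (<⇒≱ (reversed-first< b bd) (≤-trans (subst (b ≤_) (punchOutℕ-≥ (<⇒≤ rp<r0)) le) (<⇒≤ rp<r0)))
    label-symmetric : ∀ v → v < n → label (n ∸ 1 ∸ v) ≡ label v
    label-symmetric v v<n = begin
      label (n ∸ 1 ∸ v)          ≡⟨ cong (λ z → label (n ∸ 1 ∸ z)) τj≡v ⟨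
      label (n ∸ 1 ∸ image τ j)  ≡⟨ label-reversed j ⟩
      label (toℕ j)              ≡⟨ pres F.zero j ⟨
      label (image τ j)          ≡⟨ cong label τj≡v ⟩
      label v                    ∎
      where
      open ≡-Reasoning
      j : Fin n
      j = τ ⟨$⟩ˡ fromℕ< v<n
      τj≡v : image τ j ≡ v
      τj≡v = trans (cong toℕ (inverseʳ τ)) (FP.toℕ-fromℕ< v<n)

  Comp-descending⇒palindromic : 1 ≤ n → ∀ d (ρ : Perm (suc (d + n))) → Comp (suc (d + n)) (S_Π f) ρ → Descending ρ → Palindromic f
  Comp-descending⇒palindromic 1≤n zero ρ C desc = Comp-descending⇒palindromic₀ ρ C desc
  Comp-descending⇒palindromic 1≤n (suc d) ρ C desc =
    Comp-descending⇒palindromic 1≤n d (remove one ρ) (Comp-remove (suc (d + n)) ρ C one)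
      (remove-inner-descending ρ one ≤-refl (≤-trans 1≤n (m≤n+m n d)) desc)
    where
    one : Fin (suc (suc (d + n)))
    one = F.suc F.zero

T-and-allFin : ∀ {N} (g : Fin N → Bool) → T (and (map g (allFin N))) ⇔ (∀ i → T (g i))
T-and-allFin {N} g = mk⇔ (λ t → AllP.tabulate⁻ (AllP.all⁺ g (allFin N) t)) (λ h → AllP.all⁻ g (AllP.tabulate⁺ h))

count : (ℕ → Bool) → ℕ → ℕ → ℕ
count b off zero = zero
count b off (suc N) = (if b off then 1 else 0) + count b (suc off) N

count-tabulate : ∀ {n} N off (h : Fin N → Fin n) → (∀ j → toℕ (h j) ≡ off + toℕ j) → (b : ℕ → Bool) →
  length (filter (λ j → T? (b (toℕ j))) (tabulate h)) ≡ count b off N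
count-tabulate zero off h toℕ-h b = refl
count-tabulate (suc N) off h toℕ-h b with b (toℕ (h F.zero)) | b off | cong b (trans (toℕ-h F.zero) (+-identityʳ off))
... | true  | .true  | refl = cong suc (count-tabulate N (suc off) (h ∘ F.suc) (λ j → trans (toℕ-h (F.suc j)) (+-suc off (toℕ j))) b)
... | false | .false | refl = count-tabulate N (suc off) (h ∘ F.suc) (λ j → trans (toℕ-h (F.suc j)) (+-suc off (toℕ j))) b

count-allFin : ∀ n (b : ℕ → Bool) → length (filter (λ j → T? (b (toℕ j))) (allFin n)) ≡ count b 0 n
count-allFin n b = count-tabulate n 0 id (λ j → refl) b

count-interval : ∀ (b : ℕ → Bool) N off lo hi → off ≤ lo → lo ≤ hi → hi ≤ off + N →
  (∀ x → off ≤ x → x < off + N → (T (b x) → lo ≤ x × x < hi) × (lo ≤ x → x < hi → T (b x))) →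
  count b off N ≡ hi ∸ lo
count-interval b zero off lo hi off≤lo lo≤hi hi≤off+0 spec = sym (m≤n⇒m∸n≡0 (≤-trans hi≤off+0 (≤-trans (≤-reflexive (+-identityʳ off)) off≤lo)))
count-interval b (suc N) off lo hi off≤lo lo≤hi hi≤ spec = step (b off) refl (m≤n⇒m<n∨m≡n off≤lo)
  where
  off<end : off < off + suc N
  off<end = subst (off <_) (sym (+-suc off N)) (s≤s (m≤m+n off N))
  spec′ : ∀ x → suc off ≤ x → x < suc off + N → (T (b x) → lo ≤ x × x < hi) × (lo ≤ x → x < hi → T (b x))
  spec′ x off<x x< = spec x (<⇒≤ off<x) (subst (x <_) (sym (+-suc off N)) x<)
  hi≤′ = subst (hi ≤_) (+-suc off N) hi≤
  step : ∀ bo → b off ≡ bo → off < lo ⊎ off ≡ lo → (if bo then 1 else 0) + count b (suc off) N ≡ hi ∸ lo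
  step true  e (inj₁ off<lo) = ⊥-elim (<⇒≱ off<lo (proj₁ (proj₁ (spec off ≤-refl off<end) (subst T (sym e) tt))))
  step false e (inj₁ off<lo) = count-interval b N (suc off) lo hi off<lo lo≤hi hi≤′ spec′
  step bo    e (inj₂ refl) with m≤n⇒m<n∨m≡n lo≤hi
  step true  e (inj₂ refl) | inj₁ lo<hi =
    trans (cong suc (count-interval b N (suc off) (suc off) hi ≤-refl lo<hi hi≤′ spec″)) (sym (+-∸-assoc 1 lo<hi))
    where
    spec″ : ∀ x → suc off ≤ x → x < suc off + N → (T (b x) → suc off ≤ x × x < hi) × (suc off ≤ x → x < hi → T (b x))
    spec″ x off<x x< = (λ t → off<x , proj₂ (proj₁ (spec′ x off<x x<) t)) , (λ _ → proj₂ (spec′ x off<x x<) (<⇒≤ off<x))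
  step false e (inj₂ refl) | inj₁ lo<hi = ⊥-elim (subst T e (proj₂ (spec off ≤-refl off<end) ≤-refl lo<hi))
  step true  e (inj₂ refl) | inj₂ refl = ⊥-elim (<-irrefl refl (proj₂ (proj₁ (spec off ≤-refl off<end) (subst T (sym e) tt))))
  step false e (inj₂ refl) | inj₂ refl =
    trans (count-interval b N (suc off) (suc off) (suc off) ≤-refl ≤-refl (s≤s (m≤m+n off N)) spec″) (trans (n∸n≡0 (suc off)) (sym (n∸n≡0 off)))
    where
    spec″ : ∀ x → suc off ≤ x → x < suc off + N → (T (b x) → suc off ≤ x × x < suc off) × (suc off ≤ x → x < suc off → T (b x))
    spec″ x off<x x< = (λ t → ⊥-elim (<⇒≱ (proj₂ (proj₁ (spec′ x off<x x<) t)) (<⇒≤ off<x))) , (λ off<x x<off → ⊥-elim (<⇒≱ x<off off<x))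

module FoldMax {X : Set} (skip : X → Bool) (val : X → ℕ) where
  g : X → ℕ → ℕ
  g x acc = if skip x then acc else (val x ⊔ acc)

  fold-≥ : ∀ {N} (h : Fin N → X) acc i → skip (h i) ≡ false → val (h i) ≤ foldr g acc (tabulate h)
  fold-≥ {suc N} h acc F.zero skip≡ with skip (h F.zero)
  fold-≥ {suc N} h acc F.zero () | true
  ... | false = m≤m⊔n (val (h F.zero)) _
  fold-≥ {suc N} h acc (F.suc i) skip≡ with skip (h F.zero)
  ... | true = fold-≥ (h ∘ F.suc) acc i skip≡
  ... | false = ≤-trans (fold-≥ (h ∘ F.suc) acc i skip≡) (m≤n⊔m (val (h F.zero)) _)

  fold-attained : ∀ {N} (h : Fin N → X) acc →
    (foldr g acc (tabulate h) ≡ acc) ⊎ (Σ (Fin N) λ i → skip (h i) ≡ false × foldr g acc (tabulate h) ≡ val (h i))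
  fold-attained {zero} h acc = inj₁ refl
  fold-attained {suc N} h acc with skip (h F.zero) in skip≡ | fold-attained (h ∘ F.suc) acc
  ... | true | inj₁ e = inj₁ e
  ... | true | inj₂ (i , skip-i , e) = inj₂ (F.suc i , skip-i , e)
  ... | false | rest with ⊔-sel (val (h F.zero)) (foldr g acc (tabulate (h ∘ F.suc)))
  ...   | inj₁ e = inj₂ (F.zero , skip≡ , e)
  ...   | inj₂ e with rest
  ...     | inj₁ e' = inj₁ (trans e e')
  ...     | inj₂ (i , skip-i , e') = inj₂ (F.suc i , skip-i , trans e e')

least : (P : ℕ → Set) → (∀ x → Dec (P x)) → ∀ k → P k → Σ ℕ λ m → P m × (∀ m' → m' < m → ¬ P m')
least P P? k Pk = go (suc k) (k , ≤-refl , Pk)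
  where
  go : ∀ k → (Σ ℕ λ b → b < k × P b) → Σ ℕ λ m → P m × (∀ m' → m' < m → ¬ P m')
  go (suc k) (b , b<k+1 , Pb) with anyUpTo? P? k
  ... | yes below = go k below
  ... | no none with m≤n⇒m<n∨m≡n (≤-pred b<k+1)
  ...   | inj₁ b<k = ⊥-elim (none (b , b<k , Pb))
  ...   | inj₂ refl = b , Pb , (λ m' m'<b Pm' → none (m' , m'<b , Pm'))

greatestBelow : (P : ℕ → Set) → (∀ x → Dec (P x)) → ∀ k → (Σ ℕ λ b → b < k × P b) →
  Σ ℕ λ m → m < k × P m × (∀ m' → m < m' → m' < k → ¬ P m')
greatestBelow P P? (suc k) (b , b<k+1 , Pb) with P? k
... | yes Pk = k , ≤-refl , Pk , (λ m' k<m' m'<k+1 _ → <⇒≱ k<m' (≤-pred m'<k+1))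
... | no ¬Pk with m≤n⇒m<n∨m≡n (≤-pred b<k+1)
...   | inj₂ refl = ⊥-elim (¬Pk Pb)
...   | inj₁ b<k with greatestBelow P P? k (b , b<k , Pb)
...     | (m , m<k , Pm , greatest) = m , m<n⇒m<1+n m<k , Pm , greatest′
  where
  greatest′ : ∀ m' → m < m' → m' < suc k → ¬ P m'
  greatest′ m' m<m' m'<k+1 Pm' with m≤n⇒m<n∨m≡n (≤-pred m'<k+1)
  ... | inj₁ m'<k = greatest m' m<m' m'<k Pm'
  ... | inj₂ refl = ¬Pk Pm'

T-implication : ∀ a b c → T (not a ∨ not b ∨ c) ⇔ (T a → T b → T c)
T-implication true true c = mk⇔ (λ t _ _ → t) (λ h → h tt tt)
T-implication true false c = mk⇔ (λ _ _ ()) (λ _ → tt)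
T-implication false b c = mk⇔ (λ _ ()) (λ _ → tt)

T-between : ∀ i j x → T (between i j x) ⇔ ((i ⊓ j ≤ x) × (x ≤ i ⊔ j))
T-between i j x = mk⇔
  (λ t → let lo , hi = ⇔to BP.T-∧ t in ≤ᵇ⇒≤ _ _ lo , ≤ᵇ⇒≤ _ _ hi)
  (λ (lo , hi) → ⇔from BP.T-∧ (≤⇒≤ᵇ lo , ≤⇒≤ᵇ hi))

module Hat {n : ℕ} (f : Partition n) (b₀ : Σ ℕ (Boundaries.Boundary f)) where
  open Boundaries f

  NoBoundaryIn : ℕ → ℕ → Set
  NoBoundaryIn u v = ∀ b → Boundary b → u < b → v < b

  sameHat⇒noBoundary : ∀ i j → T (sameHat f i j) → NoBoundaryIn (i ⊓ j) (i ⊔ j)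
  sameHat⇒noBoundary i j same b bd lo<b = ≰⇒> b≰hi
    where
    b≰hi : ¬ (b ≤ i ⊔ j)
    b≰hi b≤hi = proj₂ (proj₂ bd) (begin
      label (b ∸ 1)     ≡⟨ cong label toℕ-k ⟨
      label (toℕ k)     ≡⟨ label-toℕ k ⟩
      f k               ≡⟨ ≡ᵇ⇒≡ _ _ (⇔to (T-implication _ _ _) (⇔to (T-and-allFin _) (⇔to (T-and-allFin _) same k) l) k-between l-between) ⟩
      f l               ≡⟨ label-toℕ l ⟨
      label (toℕ l)     ≡⟨ cong label toℕ-l ⟩
      label b           ∎)
      where
      open ≡-Reasoning
      k : Fin n
      k = fromℕ< (≤-<-trans (m∸n≤m b 1) (proj₁ (proj₂ bd)))
      l : Fin n
      l = fromℕ< (proj₁ (proj₂ bd))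
      toℕ-k : toℕ k ≡ b ∸ 1
      toℕ-k = FP.toℕ-fromℕ< _
      toℕ-l : toℕ l ≡ b
      toℕ-l = FP.toℕ-fromℕ< _
      k-between : T (between i j (toℕ k))
      k-between = ⇔from (T-between i j (toℕ k)) (subst (i ⊓ j ≤_) (sym toℕ-k) (≤pred lo<b) , subst (_≤ i ⊔ j) (sym toℕ-k) (≤-trans (m∸n≤m b 1) b≤hi))
      l-between : T (between i j (toℕ l))
      l-between = ⇔from (T-between i j (toℕ l)) (subst (i ⊓ j ≤_) (sym toℕ-l) (<⇒≤ lo<b) , subst (_≤ i ⊔ j) (sym toℕ-l) b≤hi)

  noBoundary⇒sameHat : ∀ i j → NoBoundaryIn (i ⊓ j) (i ⊔ j) → T (sameHat f i j)
  noBoundary⇒sameHat i j none =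
    ⇔from (T-and-allFin _) (λ k → ⇔from (T-and-allFin _) (λ l → ⇔from (T-implication _ _ _) (λ k-between l-between →
      ≡⇒≡ᵇ _ _ (trans (sym (label-lo k k-between)) (label-lo l l-between)))))
    where
    label-lo : ∀ (k : Fin n) → T (between i j (toℕ k)) → label (i ⊓ j) ≡ f k
    label-lo k k-between = let lo≤k , k≤hi = ⇔to (T-between i j (toℕ k)) k-between in
      trans (label-constant (i ⊓ j) (toℕ k) lo≤k (FP.toℕ<n k) (λ b bd lo<b → ≤-<-trans k≤hi (none b bd lo<b))) (label-toℕ k)

  first = least Boundary boundary? (proj₁ b₀) (proj₂ b₀)
  c = proj₁ first
  c-boundary : Boundary c
  c-boundary = proj₁ (proj₂ first)
  c-least : ∀ b → Boundary b → c ≤ b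
  c-least b bd = ≮⇒≥ (λ b<c → proj₂ (proj₂ first) b b<c bd)

  last = greatestBelow Boundary boundary? n (proj₁ b₀ , proj₁ (proj₂ (proj₂ b₀)) , proj₂ b₀)
  L = proj₁ last
  L-boundary : Boundary L
  L-boundary = proj₁ (proj₂ (proj₂ last))
  L-greatest : ∀ b → Boundary b → b ≤ L
  L-greatest b bd = ≮⇒≥ (λ L<b → proj₂ (proj₂ (proj₂ last)) b L<b (proj₁ (proj₂ bd)) bd)

  hatBlockSize-interval : ∀ i lo hi → lo ≤ hi → hi ≤ n →
    (∀ x → x < n → (T (sameHat f i x) → lo ≤ x × x < hi) × (lo ≤ x → x < hi → T (sameHat f i x))) →
    hatBlockSize f i ≡ hi ∸ lo
  hatBlockSize-interval i lo hi lo≤hi hi≤n spec =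
    trans (count-allFin n (sameHat f i)) (count-interval (sameHat f i) n 0 lo hi z≤n lo≤hi hi≤n (λ x _ x<n → spec x x<n))

  cOf≡firstBoundary : cOf f ≡ c
  cOf≡firstBoundary = hatBlockSize-interval 0 0 c z≤n (<⇒≤ (proj₁ (proj₂ c-boundary))) spec
    where
    spec : ∀ x → x < n → (T (sameHat f 0 x) → 0 ≤ x × x < c) × (0 ≤ x → x < c → T (sameHat f 0 x))
    spec x x<n = (λ same → z≤n , sameHat⇒noBoundary 0 x same c c-boundary (proj₁ c-boundary))
               , (λ _ x<c → noBoundary⇒sameHat 0 x (λ b bd _ → <-≤-trans x<c (c-least b bd)))

  dOf≡n∸lastBoundary : dOf f ≡ n ∸ L
  dOf≡n∸lastBoundary = hatBlockSize-interval (n ∸ 1) L n (<⇒≤ (proj₁ (proj₂ L-boundary))) ≤-refl spec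
    where
    spec : ∀ x → x < n → (T (sameHat f (n ∸ 1) x) → L ≤ x × x < n) × (L ≤ x → x < n → T (sameHat f (n ∸ 1) x))
    spec x x<n = (λ same → ≮⇒≥ (λ x<L → <⇒≱ (sameHat⇒noBoundary (n ∸ 1) x same L L-boundary (subst (_< L) (sym (m≥n⇒m⊓n≡n (≤pred x<n))) x<L))
                                          (subst (L ≤_) (sym (m≥n⇒m⊔n≡m (≤pred x<n))) (≤pred (proj₁ (proj₂ L-boundary))))) , x<n)
               , (λ L≤x _ → noBoundary⇒sameHat (n ∸ 1) x (λ b bd x<b → ⊥-elim (<⇒≱ (≤-<-trans L≤x (subst (_< b) (m≥n⇒m⊓n≡n (≤pred x<n)) x<b)) (L-greatest b bd))))

module Middle {n : ℕ} (f : Partition n) (2≤n : 2 ≤ n) (b₀ : Σ ℕ (Boundaries.Boundary f)) where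
  open Boundaries f
  open Hat f b₀

  outer : ℕ → Bool
  outer j = sameHat f 0 j ∨ sameHat f (n ∸ 1) j

  middle⇒¬outer : ∀ j → c ≤ j → j < L → outer j ≡ false
  middle⇒¬outer j c≤j j<L with outer j in e
  ... | false = refl
  ... | true = ⊥-elim ([ in-first , in-last ]′ (⇔to BP.T-∨ (subst T (sym e) tt)))
    where
    j≤n-1 : j ≤ n ∸ 1
    j≤n-1 = ≤pred (<-trans j<L (proj₁ (proj₂ L-boundary)))
    in-first : ¬ T (sameHat f 0 j)
    in-first same = <⇒≱ (sameHat⇒noBoundary 0 j same c c-boundary (proj₁ c-boundary)) c≤j
    in-last : ¬ T (sameHat f (n ∸ 1) j)
    in-last same = <⇒≱ (proj₁ (proj₂ L-boundary))
      (subst (_≤ L) (suc-∸1 (≤-trans (s≤s z≤n) 2≤n))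
        (subst (_< L) (m≥n⇒m⊔n≡m j≤n-1) (sameHat⇒noBoundary (n ∸ 1) j same L L-boundary (subst (_< L) (sym (m≥n⇒m⊓n≡n j≤n-1)) j<L))))

  ¬outer⇒middle : ∀ j → j < n → outer j ≡ false → c ≤ j × j < L
  ¬outer⇒middle j j<n e =
    ≮⇒≥ (λ j<c → ¬outer (inj₁ (noBoundary⇒sameHat 0 j (λ b bd _ → <-≤-trans j<c (c-least b bd))))) ,
    ≰⇒> (λ L≤j → ¬outer (inj₂ (noBoundary⇒sameHat (n ∸ 1) j (λ b bd j<b →
      ⊥-elim (<⇒≱ (≤-<-trans L≤j (subst (_< b) (m≥n⇒m⊓n≡n (≤pred j<n)) j<b)) (L-greatest b bd))))))
    where
    ¬outer : ¬ (T (sameHat f 0 j) ⊎ T (sameHat f (n ∸ 1) j))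
    ¬outer t = subst T e (⇔from BP.T-∨ t)

  hatBlockSize-between : ∀ j s s' → Boundary s → s ≤ j → (∀ b → Boundary b → s < b → b ≤ j → ⊥) →
    Boundary s' → j < s' → (∀ b → Boundary b → j < b → s' ≤ b) → hatBlockSize f j ≡ s' ∸ s
  hatBlockSize-between j s s' bd-s s≤j s-greatest bd-s' j<s' s'-least =
    hatBlockSize-interval j s s' (<⇒≤ (≤-<-trans s≤j j<s')) (<⇒≤ (proj₁ (proj₂ bd-s'))) spec
    where
    spec : ∀ x → x < n → (T (sameHat f j x) → s ≤ x × x < s') × (s ≤ x → x < s' → T (sameHat f j x))
    spec x _ = (λ same → s≤x same , x<s' same) , (λ s≤x x<s' → noBoundary⇒sameHat j x (none s≤x x<s'))
      where
      s≤x : T (sameHat f j x) → s ≤ x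
      s≤x same = ≮⇒≥ (λ x<s → <⇒≱ (sameHat⇒noBoundary j x same s bd-s (≤-<-trans (m⊓n≤n j x) x<s)) (≤-trans s≤j (m≤m⊔n j x)))
      x<s' : T (sameHat f j x) → x < s'
      x<s' same = ≰⇒> (λ s'≤x → <⇒≱ (sameHat⇒noBoundary j x same s' bd-s' (≤-<-trans (m⊓n≤m j x) j<s')) (≤-trans s'≤x (m≤n⊔m j x)))
      none : s ≤ x → x < s' → NoBoundaryIn (j ⊓ x) (j ⊔ x)
      none s≤x x<s' b bd lo<b = ⊔-pres-<m j<b (<-≤-trans x<s' (s'-least b bd j<b))
        where
        j<b : j < b
        j<b = ≰⇒> (s-greatest b bd (≤-<-trans (⊓-glb s≤j s≤x) lo<b))

  module FM = FoldMax (λ (j : Fin n) → outer (toℕ j)) (λ j → hatBlockSize f (toℕ j))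

  nextBoundary : ∀ s → s < L → Σ ℕ λ s' → Boundary s' × s < s' × (∀ b → Boundary b → s < b → s' ≤ b)
  nextBoundary s s<L with least (λ x → s < x × Boundary x) (λ x → (s <? x) ×-dec (boundary? x)) L (s<L , L-boundary)
  ... | s' , (s<s' , bd-s') , least-s' = s' , bd-s' , s<s' , (λ b bd s<b → ≮⇒≥ (λ b<s' → least-s' b b<s' (s<b , bd)))

  gap≤MOf : ∀ s → Boundary s → s < L → ∀ s' → Boundary s' → s < s' → (∀ b → Boundary b → s < b → s' ≤ b) → s' ∸ s ≤ MOf f
  gap≤MOf s bd-s s<L s' bd-s' s<s' s'-least =
    subst (_≤ MOf f) size (FM.fold-≥ id 1 i (subst (λ z → outer z ≡ false) (sym toℕ-i) (middle⇒¬outer s (c-least s bd-s) s<L)))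
    where
    i : Fin n
    i = fromℕ< (proj₁ (proj₂ bd-s))
    toℕ-i : toℕ i ≡ s
    toℕ-i = FP.toℕ-fromℕ< (proj₁ (proj₂ bd-s))
    size : hatBlockSize f (toℕ i) ≡ s' ∸ s
    size = subst (λ z → hatBlockSize f z ≡ s' ∸ s) (sym toℕ-i)
             (hatBlockSize-between s s s' bd-s ≤-refl (λ b _ s<b b≤s → <⇒≱ s<b b≤s) bd-s' s<s' s'-least)

  MOf-attained : (MOf f ≡ 1) ⊎ (Σ ℕ λ s → Σ ℕ λ s' → Boundary s × Boundary s' × s < s' × (∀ b → Boundary b → s < b → s' ≤ b) × MOf f ≡ s' ∸ s)
  MOf-attained with FM.fold-attained id 1
  ... | inj₁ e = inj₁ e
  ... | inj₂ (i , inner , e) = inj₂ (s , s' , bd-s , bd-s' , ≤-<-trans s≤j j<s' , s'-least′ , trans e size)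
    where
    j = toℕ i
    middle = ¬outer⇒middle j (FP.toℕ<n i) inner
    previous = greatestBelow Boundary boundary? (suc j) (c , s≤s (proj₁ middle) , c-boundary)
    s = proj₁ previous
    s≤j : s ≤ j
    s≤j = ≤-pred (proj₁ (proj₂ previous))
    bd-s = proj₁ (proj₂ (proj₂ previous))
    s-greatest : ∀ b → Boundary b → s < b → b ≤ j → ⊥
    s-greatest b bd s<b b≤j = proj₂ (proj₂ (proj₂ previous)) b s<b (s≤s b≤j) bd
    next = nextBoundary j (proj₂ middle)
    s' = proj₁ next
    bd-s' = proj₁ (proj₂ next)
    j<s' = proj₁ (proj₂ (proj₂ next))
    s'-least : ∀ b → Boundary b → j < b → s' ≤ b
    s'-least = proj₂ (proj₂ (proj₂ next))
    s'-least′ : ∀ b → Boundary b → s < b → s' ≤ b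
    s'-least′ b bd s<b = s'-least b bd (≰⇒> (s-greatest b bd s<b))
    size : hatBlockSize f j ≡ s' ∸ s
    size = hatBlockSize-between j s s' bd-s s≤j s-greatest bd-s' j<s' s'-least

-- For a permutation of [m] and e = m − d this is membership in S^{c,d}_m.
Framed : ∀ {m} → ℕ → ℕ → (Fin m → ℕ) → Set
Framed c e h = ∀ x → (toℕ x < c → h x < c) × (e ≤ toℕ x → e ≤ h x) × (c ≤ toℕ x → toℕ x < e → h x ≡ toℕ x)

framed-remove : ∀ {m} c e (ρ : Perm (suc m)) → c ≤ e → Framed c (suc e) (image ρ) → ∀ x → Framed c e (image (remove x ρ))
framed-remove c e ρ c≤e framed x j =
  (λ J<c → subst (_< c) (sym image-j) (low J<c)) ,
  (λ e≤J → subst (e ≤_) (sym image-j) (high e≤J)) ,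
  (λ c≤J J<e → trans image-j (middle c≤J J<e))
  where
  X = toℕ x
  J = toℕ j
  p = punchIn x j
  a = image ρ x
  u = image ρ p
  image-j : image (remove x ρ) j ≡ punchOutℕ a u
  image-j = image-remove x ρ j
  u<c : toℕ p < c → u < c
  u<c = proj₁ (framed p)
  e<u : suc e ≤ toℕ p → suc e ≤ u
  e<u = proj₁ (proj₂ (framed p))
  u≡ : ∀ {v} → toℕ p ≡ v → c ≤ v → v < suc e → u ≡ v
  u≡ p≡v c≤v v<e+1 = trans (proj₂ (proj₂ (framed p)) (subst (c ≤_) (sym p≡v) c≤v) (subst (_< suc e) (sym p≡v) v<e+1)) p≡v
  p≡J : J < X → toℕ p ≡ J
  p≡J J<X = trans (toℕ-punchIn x j) (punchInℕ-< J<X)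
  p≡J+1 : X ≤ J → toℕ p ≡ suc J
  p≡J+1 X≤J = trans (toℕ-punchIn x j) (punchInℕ-≥ X≤J)

  low : J < c → punchOutℕ a u < c
  low J<c with J <? X
  ... | yes J<X = ≤-<-trans (punchOutℕ≤ a u) (u<c (subst (_< c) (sym (p≡J J<X)) J<c))
  ... | no J≮X with m≤n⇒m<n∨m≡n J<c
  ...   | inj₁ J+1<c = ≤-<-trans (punchOutℕ≤ a u) (u<c (subst (_< c) (sym (p≡J+1 (≮⇒≥ J≮X))) J+1<c))
  ...   | inj₂ J+1≡c = subst (_< c) (sym (punchOutℕ-< a<u)) (subst (λ v → v ∸ 1 < c) (sym u≡c) (≤-reflexive (suc-∸1 (subst (1 ≤_) J+1≡c (s≤s z≤n)))))
    where
    u≡c : u ≡ c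
    u≡c = u≡ (trans (p≡J+1 (≮⇒≥ J≮X)) J+1≡c) ≤-refl (s≤s c≤e)
    a<u : a < u
    a<u = subst (a <_) (sym u≡c) (proj₁ (framed x) (≤-<-trans (≮⇒≥ J≮X) J<c))

  high : e ≤ J → e ≤ punchOutℕ a u
  high e≤J with J <? X
  ... | no J≮X = ≤-trans (∸-monoˡ-≤ 1 (e<u (subst (suc e ≤_) (sym (p≡J+1 (≮⇒≥ J≮X))) (s≤s e≤J)))) (∸1≤punchOutℕ a u)
  ... | yes J<X with m≤n⇒m<n∨m≡n e≤J
  ...   | inj₁ e<J = ≤-trans (∸-monoˡ-≤ 1 (e<u (subst (suc e ≤_) (sym (p≡J J<X)) e<J))) (∸1≤punchOutℕ a u)
  ...   | inj₂ e≡J = subst (e ≤_) (sym (trans (punchOutℕ-≥ (<⇒≤ u<a)) u≡e)) ≤-refl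
    where
    u≡e : u ≡ e
    u≡e = u≡ (trans (p≡J J<X) (sym e≡J)) c≤e ≤-refl
    u<a : u < a
    u<a = subst (_< a) (sym u≡e) (proj₁ (proj₂ (framed x)) (subst (_< X) (sym e≡J) J<X))

  middle : c ≤ J → J < e → punchOutℕ a u ≡ J
  middle c≤J J<e with J <? X
  ... | yes J<X = trans (punchOutℕ-≥ (<⇒≤ u<a)) u≡J
    where
    u≡J : u ≡ J
    u≡J = u≡ (p≡J J<X) c≤J (m<n⇒m<1+n J<e)
    u<a : u < a
    u<a with X <? suc e
    ... | yes X<e+1 = subst₂ _<_ (sym u≡J) (sym (proj₂ (proj₂ (framed x)) (≤-trans c≤J (<⇒≤ J<X)) X<e+1)) J<X
    ... | no X≮e+1 = subst (_< a) (sym u≡J) (<-≤-trans (m<n⇒m<1+n J<e) (proj₁ (proj₂ (framed x)) (≮⇒≥ X≮e+1)))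
  ... | no J≮X = trans (punchOutℕ-< a<u) (cong (_∸ 1) u≡J+1)
    where
    X≤J = ≮⇒≥ J≮X
    u≡J+1 : u ≡ suc J
    u≡J+1 = u≡ (p≡J+1 X≤J) (m≤n⇒m≤1+n c≤J) (s≤s J<e)
    a≤J : a ≤ J
    a≤J with X <? c
    ... | yes X<c = ≤-trans (<⇒≤ (proj₁ (framed x) X<c)) c≤J
    ... | no X≮c = subst (_≤ J) (sym (proj₂ (proj₂ (framed x)) (≮⇒≥ X≮c) (≤-<-trans X≤J (m<n⇒m<1+n J<e)))) X≤J
    a<u : a < u
    a<u = subst (a <_) (sym u≡J+1) (s≤s a≤J)


module FramedFunctions {m : ℕ} (c e : ℕ) where

  FramedFun : (Fin m → Fin m) → Set
  FramedFun g = Framed c e (λ x → toℕ (g x))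

  framedFun-ext : ∀ (g g' : Fin m → Fin m) → (∀ x → g x ≡ g' x) → FramedFun g → FramedFun g'
  framedFun-ext g g' g≗g' framed x =
    subst (λ z → (toℕ x < c → toℕ z < c) × (e ≤ toℕ x → e ≤ toℕ z) × (c ≤ toℕ x → toℕ x < e → toℕ z ≡ toℕ x)) (g≗g' x) (framed x)

  framedFun-id : FramedFun id
  framedFun-id x = id , id , (λ _ _ → refl)

  framedFun-∘ : ∀ (g₁ g₂ : Fin m → Fin m) → FramedFun g₁ → FramedFun g₂ → FramedFun (g₁ ∘ g₂)
  framedFun-∘ g₁ g₂ framed₁ framed₂ x =
    (λ x<c → proj₁ (framed₁ (g₂ x)) (proj₁ (framed₂ x) x<c)) ,
    (λ e≤x → proj₁ (proj₂ (framed₁ (g₂ x))) (proj₁ (proj₂ (framed₂ x)) e≤x)) ,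
    (λ c≤x x<e → trans (cong (λ z → toℕ (g₁ z)) (FP.toℕ-injective (proj₂ (proj₂ (framed₂ x)) c≤x x<e))) (proj₂ (proj₂ (framed₁ x)) c≤x x<e))

  -- Each of the three regions is mapped into itself, hence (by the other two) onto itself.
  framedFun-inverse : c ≤ e → (g g' : Fin m → Fin m) → (∀ y → g (g' y) ≡ y) → FramedFun g → FramedFun g'
  framedFun-inverse c≤e g g' g∘g' framed y = low , high , middle
    where
    i = g' y
    g-i : toℕ (g i) ≡ toℕ y
    g-i = cong toℕ (g∘g' y)
    low : toℕ y < c → toℕ i < c
    low y<c with toℕ i <? c
    ... | yes i<c = i<c
    ... | no i≮c with toℕ i <? e
    ...   | yes i<e = ⊥-elim (i≮c (subst (_< c) (trans (sym g-i) (proj₂ (proj₂ (framed i)) (≮⇒≥ i≮c) i<e)) y<c))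
    ...   | no i≮e = ⊥-elim (<⇒≱ y<c (subst (c ≤_) g-i (≤-trans c≤e (proj₁ (proj₂ (framed i)) (≮⇒≥ i≮e)))))
    high : e ≤ toℕ y → e ≤ toℕ i
    high e≤y with toℕ i <? c
    ... | yes i<c = ⊥-elim (<⇒≱ (<-≤-trans (subst (_< c) g-i (proj₁ (framed i) i<c)) c≤e) e≤y)
    ... | no i≮c with toℕ i <? e
    ...   | yes i<e = ⊥-elim (<⇒≱ (subst (_< e) (sym (trans (sym g-i) (proj₂ (proj₂ (framed i)) (≮⇒≥ i≮c) i<e))) i<e) e≤y)
    ...   | no i≮e = ≮⇒≥ i≮e
    middle : c ≤ toℕ y → toℕ y < e → toℕ i ≡ toℕ y
    middle c≤y y<e with toℕ i <? c
    ... | yes i<c = ⊥-elim (<⇒≱ (subst (_< c) g-i (proj₁ (framed i) i<c)) c≤y)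
    ... | no i≮c with toℕ i <? e
    ...   | yes i<e = trans (sym (proj₂ (proj₂ (framed i)) (≮⇒≥ i≮c) i<e)) g-i
    ...   | no i≮e = ⊥-elim (<⇒≱ y<e (subst (e ≤_) g-i (proj₁ (proj₂ (framed i)) (≮⇒≥ i≮e))))

S^⇒framed : ∀ c d m (π : Perm m) → S^ c d m π → Framed c (m ∸ d) (image π)
S^⇒framed c d m π (low , high , middle) x = proj₁ low x , proj₁ high x , (λ c≤x x< → cong toℕ (middle x c≤x x<))

framed⇒S^ : ∀ c d m (π : Perm m) → c ≤ m ∸ d → Framed c (m ∸ d) (image π) → S^ c d m π
framed⇒S^ c d m π c≤e framed =
  ((λ x → proj₁ (framed x)) , (λ j j<c → π ⟨$⟩ˡ j , proj₁ (framed⁻¹ j) j<c , inverseʳ π)) ,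
  ((λ x → proj₁ (proj₂ (framed x))) , (λ j e≤j → π ⟨$⟩ˡ j , proj₁ (proj₂ (framed⁻¹ j)) e≤j , inverseʳ π)) ,
  (λ x c≤x x<e → FP.toℕ-injective (proj₂ (proj₂ (framed x)) c≤x x<e))
  where
  framed⁻¹ : FramedFunctions.FramedFun c (m ∸ d) (π ⟨$⟩ˡ_)
  framed⁻¹ = FramedFunctions.framedFun-inverse c (m ∸ d) c≤e (π ⟨$⟩ʳ_) (π ⟨$⟩ˡ_) (λ _ → inverseʳ π) framed

Comp-reverse : ∀ {n} (f : Partition n) → (∀ j → f (opposite j) ≡ f j) → ∀ m (ρ : Perm m) →
  Comp m (S_Π f) ρ → Comp m (S_Π f) (ρ ∘ₚ reverse)
Comp-reverse f pal m ρ C τ (e , e-increasing , e-order) = preservesLabels⇒S_Π f τ (λ j → trans (sym (pal (τ ⟨$⟩ʳ j))) (pres j))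
  where
  τ′ = τ ∘ₚ reverse
  order′ : ∀ j k → (image ρ (e j) < image ρ (e k)) ⇔ (image τ′ j < image τ′ k)
  order′ j k = mk⇔ (λ lt → opposite-< (τ ⟨$⟩ʳ k) (τ ⟨$⟩ʳ j) (⇔to (e-order k j) (opposite-< (ρ ⟨$⟩ʳ e j) (ρ ⟨$⟩ʳ e k) lt)))
                   (λ lt → opposite-<⁻ (ρ ⟨$⟩ʳ e j) (ρ ⟨$⟩ʳ e k) (⇔from (e-order k j) (opposite-<⁻ (τ ⟨$⟩ʳ k) (τ ⟨$⟩ʳ j) lt)))
  pres : PreservesLabels f τ′
  pres = S_Π⇒preservesLabels f τ′ (C τ′ (e , e-increasing , order′))

-- For c = d the elements of ⟨S^{c,c}_m, δ_m⟩ are the framed permutations and the framed ones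
-- followed by δ_m.
module Flips (c m : ℕ) (c≤e : c ≤ m ∸ c) where
  e = m ∸ c
  open FramedFunctions {m} c e

  framedFun-conj : ∀ g → FramedFun g → FramedFun (λ x → opposite (g (opposite x)))
  framedFun-conj g framed x = low , high , middle
    where
    X = toℕ x
    x̄ = opposite x
    v = toℕ (g x̄)
    x<m : X < m
    x<m = FP.toℕ<n x
    v<m : v < m
    v<m = FP.toℕ<n (g x̄)
    m∸e≡c : m ∸ e ≡ c
    m∸e≡c = m∸[m∸n]≡n (≤-trans c≤e (m∸n≤m m c))
    reflect : ∀ {w} → e ≤ w → w < m → m ∸ suc w < c
    reflect e≤w w<m = ≤-<-trans (∸-monoʳ-≤ m (s≤s e≤w)) (subst (m ∸ suc e <_) m∸e≡c (∸-monoʳ-< ≤-refl (≤-<-trans e≤w w<m)))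
    low : X < c → toℕ (opposite (g x̄)) < c
    low X<c = subst (_< c) (sym (FP.opposite-prop (g x̄))) (reflect (proj₁ (proj₂ (framed x̄)) e≤x̄) v<m)
      where
      e≤x̄ : e ≤ toℕ x̄
      e≤x̄ = subst (e ≤_) (sym (FP.opposite-prop x)) (∸-monoʳ-≤ m X<c)
    high : e ≤ X → e ≤ toℕ (opposite (g x̄))
    high e≤X = subst (e ≤_) (sym (FP.opposite-prop (g x̄))) (∸-monoʳ-≤ m (proj₁ (framed x̄) x̄<c))
      where
      x̄<c : toℕ x̄ < c
      x̄<c = subst (_< c) (sym (FP.opposite-prop x)) (reflect e≤X x<m)
    middle : c ≤ X → X < e → toℕ (opposite (g x̄)) ≡ X
    middle c≤X X<e = trans (FP.opposite-prop (g x̄)) (trans (cong (λ z → m ∸ suc z) g-x̄) (trans (sym (FP.opposite-prop x̄)) (cong toℕ (FP.opposite-involutive x))))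
      where
      c≤x̄ : c ≤ toℕ x̄
      c≤x̄ = subst (c ≤_) (sym (FP.opposite-prop x)) (subst (_≤ m ∸ suc X) m∸e≡c (∸-monoʳ-≤ m X<e))
      x̄<e : toℕ x̄ < e
      x̄<e = subst (_< e) (sym (FP.opposite-prop x)) (∸-monoʳ-< (s≤s c≤X) x<m)
      g-x̄ : v ≡ toℕ x̄
      g-x̄ = proj₂ (proj₂ (framed x̄)) c≤x̄ x̄<e

  FramedOrFlipped : (Fin m → Fin m) → Set
  FramedOrFlipped g = FramedFun g ⊎ FramedFun (λ x → opposite (g x))

  framedOrFlipped-ext : ∀ g g' → (∀ x → g x ≡ g' x) → FramedOrFlipped g → FramedOrFlipped g'
  framedOrFlipped-ext g g' h (inj₁ z) = inj₁ (framedFun-ext g g' h z)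
  framedOrFlipped-ext g g' h (inj₂ z) = inj₂ (framedFun-ext (λ x → opposite (g x)) (λ x → opposite (g' x)) (λ x → cong opposite (h x)) z)

  framedOrFlipped-∘ : ∀ g1 g2 → FramedOrFlipped g1 → FramedOrFlipped g2 → FramedOrFlipped (λ x → g1 (g2 x))
  framedOrFlipped-∘ g1 g2 (inj₁ z1) (inj₁ z2) = inj₁ (framedFun-∘ g1 g2 z1 z2)
  framedOrFlipped-∘ g1 g2 (inj₁ z1) (inj₂ z2) = inj₂ (framedFun-ext (λ x → opposite (g1 (opposite (opposite (g2 x))))) (λ x → opposite (g1 (g2 x)))
     (λ x → cong (λ z → opposite (g1 z)) (FP.opposite-involutive (g2 x)))
     (framedFun-∘ (λ x → opposite (g1 (opposite x))) (λ x → opposite (g2 x)) (framedFun-conj g1 z1) z2))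
  framedOrFlipped-∘ g1 g2 (inj₂ z1) (inj₁ z2) = inj₂ (framedFun-∘ (λ x → opposite (g1 x)) g2 z1 z2)
  framedOrFlipped-∘ g1 g2 (inj₂ z1) (inj₂ z2) = inj₁ (framedFun-ext (λ x → opposite (opposite (g1 (opposite (opposite (g2 x)))))) (λ x → g1 (g2 x))
     (λ x → trans (FP.opposite-involutive _) (cong g1 (FP.opposite-involutive (g2 x))))
     (framedFun-∘ (λ x → opposite (opposite (g1 (opposite x)))) (λ x → opposite (g2 x)) (framedFun-conj (λ x → opposite (g1 x)) z1) z2))

  framedOrFlipped-inv : ∀ g g' → (∀ y → g (g' y) ≡ y) → FramedOrFlipped g → FramedOrFlipped g'
  framedOrFlipped-inv g g' gi (inj₁ z) = inj₁ (framedFun-inverse c≤e g g' gi z)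
  framedOrFlipped-inv g g' gi (inj₂ z) = inj₂ (framedFun-ext (λ x → opposite (g' (opposite (opposite x)))) (λ x → opposite (g' x))
     (λ x → cong (λ z → opposite (g' z)) (FP.opposite-involutive x))
     (framedFun-conj (λ y → g' (opposite y))
       (framedFun-inverse c≤e (λ x → opposite (g x)) (λ y → g' (opposite y)) (λ y → trans (cong opposite (gi (opposite y))) (FP.opposite-involutive y)) z)))

  generated⇒framedOrFlipped : ∀ π → Generated (S^ c c m) π → FramedOrFlipped (π ⟨$⟩ʳ_)
  generated⇒framedOrFlipped π (gen .π s) = inj₁ (S^⇒framed c c m π s)
  generated⇒framedOrFlipped π (δgen .π h) =
    inj₂ (framedFun-ext id (λ x → opposite (π ⟨$⟩ʳ x)) (λ x → sym (trans (cong opposite (h x)) (FP.opposite-involutive x))) framedFun-id)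
  generated⇒framedOrFlipped .(π ∘ₚ σ) (comp π σ gπ gσ) =
    framedOrFlipped-∘ (σ ⟨$⟩ʳ_) (π ⟨$⟩ʳ_) (generated⇒framedOrFlipped σ gσ) (generated⇒framedOrFlipped π gπ)
  generated⇒framedOrFlipped .(flip π) (inv π gπ) = framedOrFlipped-inv (π ⟨$⟩ʳ_) (π ⟨$⟩ˡ_) (λ y → inverseʳ π) (generated⇒framedOrFlipped π gπ)
  generated⇒framedOrFlipped σ (ext π .σ h gπ) = framedOrFlipped-ext (π ⟨$⟩ʳ_) (σ ⟨$⟩ʳ_) h (generated⇒framedOrFlipped π gπ)

module Sufficiency {n : ℕ} (f : Partition n) (2≤n : 2 ≤ n) (b₀ : Σ ℕ (Boundaries.Boundary f)) where
  open Boundaries f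
  open Hat f b₀
  open Middle f 2≤n b₀

  d₀ = n ∸ L
  L<n : L < n
  L<n = proj₁ (proj₂ L-boundary)
  d₀≤n : d₀ ≤ n
  d₀≤n = m∸n≤m n L
  n∸d₀≡L : n ∸ d₀ ≡ L
  n∸d₀≡L = m∸[m∸n]≡n (<⇒≤ L<n)
  c≤L : c ≤ L
  c≤L = c-least L L-boundary

  framed⇒preservesLabels : (ρ : Perm n) → Framed c L (image ρ) → PreservesLabels f ρ
  framed⇒preservesLabels ρ framed x = trans (sym (label-toℕ (ρ ⟨$⟩ʳ x))) (trans same (label-toℕ x))
    where
    X = toℕ x
    v = image ρ x
    same : label v ≡ label X
    same with X <? c
    ... | yes X<c = trans (sym (label-constant 0 v z≤n (image< ρ x) (λ b bd _ → <-≤-trans (proj₁ (framed x) X<c) (c-least b bd))))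
                          (label-constant 0 X z≤n (FP.toℕ<n x) (λ b bd _ → <-≤-trans X<c (c-least b bd)))
    ... | no X≮c with X <? L
    ...   | yes X<L = cong label (proj₂ (proj₂ (framed x)) (≮⇒≥ X≮c) X<L)
    ...   | no X≮L = trans (sym (label-constant L v (proj₁ (proj₂ (framed x)) (≮⇒≥ X≮L)) (image< ρ x) (λ b bd L<b → ⊥-elim (<⇒≱ L<b (L-greatest b bd)))))
                           (label-constant L X (≮⇒≥ X≮L) (FP.toℕ<n x) (λ b bd L<b → ⊥-elim (<⇒≱ L<b (L-greatest b bd))))

  framed⇒Comp : ∀ m → n ≤ m → (ρ : Perm m) → Framed c (m ∸ d₀) (image ρ) → Comp m (S_Π f) ρ
  framed⇒Comp = Comp-S_Π-byRemoval f (λ k ρ → Framed c (k ∸ d₀) (image ρ)) base step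
    where
    base : ∀ ρ → Framed c (n ∸ d₀) (image ρ) → PreservesLabels f ρ
    base ρ framed = framed⇒preservesLabels ρ (subst (λ z → Framed c z (image ρ)) n∸d₀≡L framed)
    step : ∀ k ρ → n ≤ k → Framed c (suc k ∸ d₀) (image ρ) → ∀ x → Framed c (k ∸ d₀) (image (remove x ρ))
    step k ρ n≤k framed = framed-remove c (k ∸ d₀) ρ c≤ (subst (λ z → Framed c z (image ρ)) (+-∸-assoc 1 (≤-trans d₀≤n n≤k)) framed)
      where
      c≤ : c ≤ k ∸ d₀
      c≤ = ≤-trans c≤L (subst (_≤ k ∸ d₀) n∸d₀≡L (∸-monoˡ-≤ d₀ n≤k))

  suc[d+n]∸d₀ : ∀ d → suc (d + n) ∸ d₀ ≡ suc (d + L)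
  suc[d+n]∸d₀ d = trans (+-∸-assoc (suc d) d₀≤n) (cong (suc d +_) n∸d₀≡L)

  -- A middle position X that is not Near (suc d) is the last one of its block of Π̂, at
  -- distance suc d from the block start s (as the block has at most suc (suc d) points),
  -- so the splits at s + d and at the next boundary pin it down.
  splitsNear⇒framed : ∀ d → MOf f ≤ suc (suc d) → (ρ : Perm (suc (d + n))) → SplitsNear (suc d) (image ρ) →
    Framed c (suc (d + n) ∸ d₀) (image ρ)
  splitsNear⇒framed d M≤ ρ split = subst (λ z → Framed c z (image ρ)) (sym (suc[d+n]∸d₀ d)) framed
    where
    near-c : Near (suc d) c
    near-c = c , c-boundary , ≤-refl , subst (c <_) (sym (+-suc c d)) (s≤s (m≤m+n c d))
    near-d+L : Near (suc d) (d + L)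
    near-d+L = L , L-boundary , m≤n+m L d , subst (_< L + suc d) (+-comm L d) (subst (L + d <_) (sym (+-suc L d)) ≤-refl)
    framed : Framed c (suc (d + L)) (image ρ)
    framed x = proj₁ (split c near-c x) , proj₁ (proj₂ (split (d + L) near-d+L x)) , middle
      where
      X = toℕ x
      middle : c ≤ X → X < suc (d + L) → image ρ x ≡ X
      middle c≤X X<E with near? (suc d) X
      ... | yes near-X = proj₂ (proj₂ (split X near-X x)) refl
      ... | no ¬near-X = ≤-antisym ρx≤X X≤ρx
        where
        previous = greatestBelow Boundary boundary? (suc X) (c , s≤s c≤X , c-boundary)
        s = proj₁ previous
        s≤X : s ≤ X
        s≤X = ≤-pred (proj₁ (proj₂ previous))
        bd-s = proj₁ (proj₂ (proj₂ previous))
        s-greatest : ∀ b → Boundary b → s < b → b ≤ X → ⊥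
        s-greatest b bd s<b b≤X = proj₂ (proj₂ (proj₂ previous)) b s<b (s≤s b≤X) bd
        s+d+1≤X : s + suc d ≤ X
        s+d+1≤X = ≮⇒≥ (λ X< → ¬near-X (s , bd-s , s≤X , X<))
        s<L : s < L
        s<L with m≤n⇒m<n∨m≡n (L-greatest s bd-s)
        ... | inj₁ s<L = s<L
        ... | inj₂ s≡L = ⊥-elim (¬near-X (L , L-boundary , subst (_≤ X) s≡L s≤X ,
                                          subst (X <_) (trans (cong suc (+-comm d L)) (sym (+-suc L d))) X<E))
        next = nextBoundary s s<L
        s' = proj₁ next
        bd-s' = proj₁ (proj₂ next)
        s<s' = proj₁ (proj₂ (proj₂ next))
        X<s' : X < s'
        X<s' = ≰⇒> (s-greatest s' bd-s' s<s')
        s'≤ : s' ≤ s + suc (suc d)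
        s'≤ = subst (_≤ s + suc (suc d)) (m+[n∸m]≡n (<⇒≤ s<s'))
                (+-monoʳ-≤ s (≤-trans (gap≤MOf s bd-s s<L s' bd-s' s<s' (proj₂ (proj₂ (proj₂ next)))) M≤))
        s+d+2≡ : s + suc (suc d) ≡ suc (suc (s + d))
        s+d+2≡ = trans (+-suc s (suc d)) (cong suc (+-suc s d))
        X≡ : X ≡ suc (s + d)
        X≡ = ≤-antisym (≤-pred (subst (X <_) s+d+2≡ (<-≤-trans X<s' s'≤))) (subst (_≤ X) (+-suc s d) s+d+1≤X)
        near-s+d : Near (suc d) (s + d)
        near-s+d = s , bd-s , m≤m+n s d , subst (s + d <_) (sym (+-suc s d)) ≤-refl
        near-s' : Near (suc d) s'
        near-s' = s' , bd-s' , ≤-refl , subst (s' <_) (sym (+-suc s' d)) (s≤s (m≤m+n s' d))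
        X≤ρx : X ≤ image ρ x
        X≤ρx = subst (_≤ image ρ x) (sym X≡) (proj₁ (proj₂ (split (s + d) near-s+d x)) (subst (s + d <_) (sym X≡) ≤-refl))
        ρx≤X : image ρ x ≤ X
        ρx≤X = ≤-pred (<-≤-trans (proj₁ (split s' near-s' x) X<s') (≤-trans s'≤ (≤-reflexive (trans s+d+2≡ (cong suc (sym X≡))))))

FixedOutside : ∀ {m} → ℕ → ℕ → Perm m → Set
FixedOutside lo hi ρ = ∀ x → (toℕ x < lo ⊎ hi < toℕ x) → image ρ x ≡ toℕ x

fixedOutside-inside : ∀ {m} lo hi (ρ : Perm m) → FixedOutside lo hi ρ → ∀ x → lo ≤ toℕ x → toℕ x ≤ hi → lo ≤ image ρ x × image ρ x ≤ hi
fixedOutside-inside lo hi ρ fixed x lo≤x x≤hi =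
  ≮⇒≥ (λ ρx<lo → outside (inj₁ (subst (_< lo) (sym toℕ-y) ρx<lo))) ,
  ≮⇒≥ (λ hi<ρx → outside (inj₂ (subst (hi <_) (sym toℕ-y) hi<ρx)))
  where
  y = fromℕ< (image< ρ x)
  toℕ-y : toℕ y ≡ image ρ x
  toℕ-y = FP.toℕ-fromℕ< (image< ρ x)
  -- y = ρ x would be fixed, forcing y = x.
  x≡y : toℕ y < lo ⊎ hi < toℕ y → toℕ x ≡ toℕ y
  x≡y out = cong toℕ (sym (image-injective ρ (trans (fixed y out) toℕ-y)))
  outside : ¬ (toℕ y < lo ⊎ hi < toℕ y)
  outside out@(inj₁ y<lo) = <⇒≱ (subst (_< lo) (sym (x≡y out)) y<lo) lo≤x
  outside out@(inj₂ hi<y) = <⇒≱ (subst (hi <_) (sym (x≡y out)) hi<y) x≤hi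

fixedOutside-remove : ∀ {m} lo hi (ρ : Perm (suc m)) → FixedOutside (suc lo) hi ρ → ∀ x → FixedOutside lo hi (remove x ρ)
fixedOutside-remove lo hi ρ fixed x j out = trans (image-remove x ρ j) shifted
  where
  X = toℕ x
  J = toℕ j
  p = punchIn x j
  a = image ρ x
  u = image ρ p
  a-fixed-or-inside : (a ≡ X) ⊎ ((suc lo ≤ X × X ≤ hi) × (suc lo ≤ a × a ≤ hi))
  a-fixed-or-inside with X <? suc lo | hi <? X
  ... | yes X<lo+1 | _ = inj₁ (fixed x (inj₁ X<lo+1))
  ... | no _ | yes hi<X = inj₁ (fixed x (inj₂ hi<X))
  ... | no X≮lo+1 | no hi≮X = inj₂ ((≮⇒≥ X≮lo+1 , ≮⇒≥ hi≮X) , fixedOutside-inside (suc lo) hi ρ fixed x (≮⇒≥ X≮lo+1) (≮⇒≥ hi≮X))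
  shifted : punchOutℕ a u ≡ J
  shifted with J <? X
  ... | yes J<X = trans (punchOutℕ-≥ (<⇒≤ (subst (_< a) (sym u≡J) J<a))) u≡J
    where
    p≡J : toℕ p ≡ J
    p≡J = trans (toℕ-punchIn x j) (punchInℕ-< J<X)
    u≡J : u ≡ J
    u≡J = trans (fixed p ([ (λ J<lo → inj₁ (subst (_< suc lo) (sym p≡J) (m<n⇒m<1+n J<lo)))
                          , (λ hi<J → inj₂ (subst (hi <_) (sym p≡J) hi<J)) ]′ out)) p≡J
    J<a : J < a
    J<a = by a-fixed-or-inside out
      where
      by : (a ≡ X) ⊎ ((suc lo ≤ X × X ≤ hi) × (suc lo ≤ a × a ≤ hi)) → J < lo ⊎ hi < J → J < a
      by (inj₁ a≡X) _ = subst (J <_) (sym a≡X) J<X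
      by (inj₂ (_ , lo<a , _)) (inj₁ J<lo) = <-≤-trans (m<n⇒m<1+n J<lo) lo<a
      by (inj₂ ((_ , X≤hi) , _)) (inj₂ hi<J) = ⊥-elim (<⇒≱ hi<J (≤-trans (<⇒≤ J<X) X≤hi))
  ... | no J≮X = trans (punchOutℕ-< (subst (a <_) (sym u≡J+1) (s≤s a≤J))) (cong (_∸ 1) u≡J+1)
    where
    X≤J = ≮⇒≥ J≮X
    p≡J+1 : toℕ p ≡ suc J
    p≡J+1 = trans (toℕ-punchIn x j) (punchInℕ-≥ X≤J)
    u≡J+1 : u ≡ suc J
    u≡J+1 = trans (fixed p ([ (λ J<lo → inj₁ (subst (_< suc lo) (sym p≡J+1) (s≤s J<lo)))
                            , (λ hi<J → inj₂ (subst (hi <_) (sym p≡J+1) (m<n⇒m<1+n hi<J))) ]′ out)) p≡J+1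
    a≤J : a ≤ J
    a≤J = by a-fixed-or-inside out
      where
      by : (a ≡ X) ⊎ ((suc lo ≤ X × X ≤ hi) × (suc lo ≤ a × a ≤ hi)) → J < lo ⊎ hi < J → a ≤ J
      by (inj₁ a≡X) _ = subst (_≤ J) (sym a≡X) X≤J
      by (inj₂ (_ , _ , a≤hi)) (inj₂ hi<J) = ≤-trans a≤hi (<⇒≤ hi<J)
      by (inj₂ ((lo<X , _) , _)) (inj₁ J<lo) = ⊥-elim (<⇒≱ (≤-<-trans X≤J J<lo) (≤-pred (m≤n⇒m≤1+n lo<X)))

transpose-fixes : ∀ {m} (i j x : Fin m) → x ≢ i → x ≢ j → PC.transpose i j x ≡ x
transpose-fixes i j x x≢i x≢j with x FP.≟ i
... | yes x≡i = ⊥-elim (x≢i x≡i)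
... | no _ with x FP.≟ j
...   | yes x≡j = ⊥-elim (x≢j x≡j)
...   | no _ = refl

transpose-first : ∀ {m} (i j : Fin m) → PC.transpose i j i ≡ j
transpose-first i j with i FP.≟ i
... | yes _ = refl
... | no i≢i = ⊥-elim (i≢i refl)

Comp-reverse⇒palindromic : ∀ {n} (f : Partition n) m → n ≤ m → Comp m (S_Π f) reverse → Palindromic f
Comp-reverse⇒palindromic {n} f m n≤m C = S_Π⇒preservesLabels f reverse (C reverse (e , increasing , order))
  where
  e : Fin n → Fin m
  e j = F.inject≤ j n≤m
  toℕ-e : ∀ j → toℕ (e j) ≡ toℕ j
  toℕ-e j = FP.toℕ-inject≤ j n≤m
  increasing : StrictlyIncreasing e
  increasing j k lt = subst₂ _<_ (sym (toℕ-e j)) (sym (toℕ-e k)) lt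
  order : ∀ j k → (toℕ (opposite (e j)) < toℕ (opposite (e k))) ⇔ (toℕ (opposite j) < toℕ (opposite k))
  order j k = mk⇔ (λ lt → opposite-< k j (subst₂ _<_ (toℕ-e k) (toℕ-e j) (opposite-<⁻ (e k) (e j) lt)))
                  (λ lt → opposite-< (e k) (e j) (subst₂ _<_ (sym (toℕ-e k)) (sym (toℕ-e j)) (opposite-<⁻ k j lt)))

flipped-fixedPoint : ∀ {m} c (g : Fin m → Fin m) → FramedFunctions.FramedFun c (m ∸ c) (λ x → opposite (g x)) →
  ∀ x → g x ≡ x → c ≤ toℕ x → toℕ x < m ∸ c → m ≡ suc (toℕ x + toℕ x)
flipped-fixedPoint {m} c g framed x gx≡x c≤x x<e = begin
  m                                 ≡⟨ m∸n+n≡m (FP.toℕ<n x) ⟨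
  m ∸ suc (toℕ x) + suc (toℕ x)     ≡⟨ cong (_+ suc (toℕ x)) opposite-x ⟩
  toℕ x + suc (toℕ x)               ≡⟨ +-suc (toℕ x) (toℕ x) ⟩
  suc (toℕ x + toℕ x)               ∎
  where
  open ≡-Reasoning
  opposite-x : m ∸ suc (toℕ x) ≡ toℕ x
  opposite-x = trans (sym (FP.opposite-prop x)) (trans (cong (λ z → toℕ (opposite z)) (sym gx≡x)) (proj₂ (proj₂ (framed x)) c≤x x<e))

module Necessity {n : ℕ} (f : Partition n) (2≤n : 2 ≤ n) (b₀ : Σ ℕ (Boundaries.Boundary f)) where
  open Boundaries f
  open Reversal f
  open Hat f b₀
  open Sufficiency f 2≤n b₀

  -- Deleting a point shrinks the support by one position from the left.
  fixedOutside⇒Comp : ∀ s s' → Boundary s → s < s' → (∀ b → Boundary b → s < b → s' ≤ b) →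
    ∀ k → n ≤ k → (ρ : Perm k) → FixedOutside (s + (k ∸ n)) (s' ∸ 1) ρ → Comp k (S_Π f) ρ
  fixedOutside⇒Comp s s' bd-s s<s' s'-least = Comp-S_Π-byRemoval f (λ k ρ → FixedOutside (s + (k ∸ n)) (s' ∸ 1) ρ) base step
    where
    t = s' ∸ 1
    t<b : ∀ b → Boundary b → s < b → t < b
    t<b b bd s<b = <-≤-trans (≤-reflexive (suc-∸1 (<-≤-trans (s≤s z≤n) s<s'))) (s'-least b bd s<b)
    base : ∀ ρ → FixedOutside (s + (n ∸ n)) t ρ → PreservesLabels f ρ
    base ρ fixed₀ x = trans (sym (label-toℕ (ρ ⟨$⟩ʳ x))) (trans same (label-toℕ x))
      where
      fixed : FixedOutside s t ρ
      fixed = subst (λ z → FixedOutside z t ρ) (trans (cong (s +_) (n∸n≡0 n)) (+-identityʳ s)) fixed₀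
      X = toℕ x
      same : label (image ρ x) ≡ label X
      same with X <? s | t <? X
      ... | yes X<s | _ = cong label (fixed x (inj₁ X<s))
      ... | no _ | yes t<X = cong label (fixed x (inj₂ t<X))
      ... | no X≮s | no t≮X = trans (sym (label-constant s (image ρ x) (proj₁ inside) (image< ρ x) (λ b bd s<b → ≤-<-trans (proj₂ inside) (t<b b bd s<b))))
                                     (label-constant s X (≮⇒≥ X≮s) (FP.toℕ<n x) (λ b bd s<b → ≤-<-trans (≮⇒≥ t≮X) (t<b b bd s<b)))
        where
        inside = fixedOutside-inside s t ρ fixed x (≮⇒≥ X≮s) (≮⇒≥ t≮X)
    step : ∀ k ρ → n ≤ k → FixedOutside (s + (suc k ∸ n)) t ρ → ∀ x → FixedOutside (s + (k ∸ n)) t (remove x ρ)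
    step k ρ n≤k fixed = fixedOutside-remove (s + (k ∸ n)) t ρ (subst (λ z → FixedOutside z t ρ) (trans (cong (s +_) (+-∸-assoc 1 n≤k)) (+-suc s (k ∸ n))) fixed)

  palindromic-label : Palindromic f → ∀ y → y < n → label (n ∸ 1 ∸ y) ≡ label y
  palindromic-label pal y y<n = begin
    label (n ∸ 1 ∸ y)          ≡⟨ cong label (trans (∸-+-assoc n 1 y) (sym (trans (FP.opposite-prop j) (cong (λ z → n ∸ suc z) toℕ-j)))) ⟩
    label (toℕ (opposite j))   ≡⟨ label-toℕ (opposite j) ⟩
    f (opposite j)             ≡⟨ pal j ⟩
    f j                        ≡⟨ label-toℕ j ⟨
    label (toℕ j)              ≡⟨ cong label toℕ-j ⟩
    label y                    ∎
    where
    open ≡-Reasoning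
    j : Fin n
    j = fromℕ< y<n
    toℕ-j : toℕ j ≡ y
    toℕ-j = FP.toℕ-fromℕ< y<n

  palindromic-boundary : Palindromic f → ∀ b → Boundary b → Boundary (n ∸ b)
  palindromic-boundary pal b (1≤b , b<n , label≢) = m<n⇒0<n∸m b<n , n∸b<n , label≢′
    where
    n∸b<n : n ∸ b < n
    n∸b<n = ∸-monoʳ-< 1≤b (<⇒≤ b<n)
    mirror-before : n ∸ 1 ∸ (n ∸ b ∸ 1) ≡ b
    mirror-before = trans (cong (n ∸ 1 ∸_) (trans (∸-+-assoc n b 1) (trans (cong (n ∸_) (+-comm b 1)) (sym (∸-+-assoc n 1 b)))))
                          (m∸[m∸n]≡n (≤pred b<n))
    mirror-at : n ∸ 1 ∸ (n ∸ b) ≡ b ∸ 1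
    mirror-at = trans (∸-+-assoc n 1 (n ∸ b)) (trans (cong (n ∸_) (+-comm 1 (n ∸ b)))
                  (trans (sym (∸-+-assoc n (n ∸ b) 1)) (cong (_∸ 1) (m∸[m∸n]≡n (<⇒≤ b<n)))))
    label≢′ : label (n ∸ b ∸ 1) ≢ label (n ∸ b)
    label≢′ eq = label≢ (begin
      label (b ∸ 1)                  ≡⟨ cong label mirror-at ⟨
      label (n ∸ 1 ∸ (n ∸ b))        ≡⟨ palindromic-label pal (n ∸ b) n∸b<n ⟩
      label (n ∸ b)                  ≡⟨ eq ⟨
      label (n ∸ b ∸ 1)              ≡⟨ palindromic-label pal (n ∸ b ∸ 1) (≤-<-trans (m∸n≤m (n ∸ b) 1) n∸b<n) ⟨
      label (n ∸ 1 ∸ (n ∸ b ∸ 1))    ≡⟨ cong label mirror-before ⟩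
      label b                        ∎)
      where open ≡-Reasoning

  palindromic⇒c≡d₀ : Palindromic f → c ≡ d₀
  palindromic⇒c≡d₀ pal = ≤-antisym (c-least (n ∸ L) (palindromic-boundary pal L L-boundary))
    (subst (n ∸ L ≤_) (m∸[m∸n]≡n (<⇒≤ (proj₁ (proj₂ c-boundary)))) (∸-monoʳ-≤ n (L-greatest (n ∸ c) (palindromic-boundary pal c c-boundary))))

CompCharacterised : ∀ {n} → Partition n → ℕ → Set
CompCharacterised f m = (Comp m (S_Π f) ≐ S^ (cOf f) (dOf f) m) ⊎ (Comp m (S_Π f) ≐ Generated (S^ (cOf f) (dOf f) m))

module Main {n : ℕ} (f : Partition n) (2≤n : 2 ≤ n) (b₀ : Σ ℕ (Boundaries.Boundary f)) (d : ℕ) where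
  open Boundaries f
  open Reversal f
  open Hat f b₀
  open Middle f 2≤n b₀
  open AscendingSplits f 2≤n b₀
  open Sufficiency f 2≤n b₀
  open Necessity f 2≤n b₀

  m = suc (d + n)

  n≤m : n ≤ m
  n≤m = m≤n⇒m≤1+n (m≤n+m n d)

  S^cd : PermSet m
  S^cd = S^ (cOf f) (dOf f) m

  Characterised : Set
  Characterised = CompCharacterised f m

  c≤m∸d₀ : c ≤ m ∸ d₀
  c≤m∸d₀ = subst (c ≤_) (sym (suc[d+n]∸d₀ d)) (≤-trans c≤L (m≤n⇒m≤1+n (m≤n+m L d)))

  L<m∸d₀ : L < m ∸ d₀
  L<m∸d₀ = subst (L <_) (sym (suc[d+n]∸d₀ d)) (s≤s (m≤n+m L d))

  framed⇒S^cd : ∀ ρ → Framed c (m ∸ d₀) (image ρ) → S^cd ρ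
  framed⇒S^cd ρ framed = subst₂ (λ a b → S^ a b m ρ) (sym cOf≡firstBoundary) (sym dOf≡n∸lastBoundary) (framed⇒S^ c d₀ m ρ c≤m∸d₀ framed)

  S^cd⇒framed : ∀ ρ → S^cd ρ → Framed c (m ∸ d₀) (image ρ)
  S^cd⇒framed ρ ρ∈S = subst₂ (λ a b → Framed a (m ∸ b) (image ρ)) cOf≡firstBoundary dOf≡n∸lastBoundary (S^⇒framed (cOf f) (dOf f) m ρ ρ∈S)

  ascending-or-descending : (ρ : Perm m) → Ascending ρ ⊎ Descending ρ
  ascending-or-descending ρ with <-cmp (image ρ F.zero) (image ρ (fromℕ (d + n)))
  ... | tri< asc _ _ = inj₁ asc
  ... | tri> _ _ desc = inj₂ desc
  ... | tri≈ _ e _ = ⊥-elim (<⇒≢ (≤-trans (s≤s z≤n) (≤-trans 2≤n (m≤n+m n d))) (trans (cong toℕ (image-injective ρ e)) (FP.toℕ-fromℕ (d + n))))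

  Comp-ascending⇒framed : MOf f ≤ suc (suc d) → ∀ ρ → Comp m (S_Π f) ρ → Ascending ρ → Framed c (m ∸ d₀) (image ρ)
  Comp-ascending⇒framed M≤ ρ C asc = splitsNear⇒framed d M≤ ρ (Comp-ascending⇒splitsNear d ρ C asc)

  reverse-reverse : ∀ (π : Perm m) x → ((π ∘ₚ reverse) ∘ₚ reverse) ⟨$⟩ʳ x ≡ π ⟨$⟩ʳ x
  reverse-reverse π x = FP.opposite-involutive (π ⟨$⟩ʳ x)

  module WhenPalindromic (pal : Palindromic f) where
    c≡d₀ = palindromic⇒c≡d₀ pal

    c≤m∸c : c ≤ m ∸ c
    c≤m∸c = subst (λ z → c ≤ m ∸ z) (sym c≡d₀) c≤m∸d₀

    open FramedFunctions {m} c (m ∸ c) using (FramedFun)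
    open Flips c m c≤m∸c using (FramedOrFlipped; generated⇒framedOrFlipped)

    framedFun⇒framed : ∀ π → FramedFun (π ⟨$⟩ʳ_) → Framed c (m ∸ d₀) (image π)
    framedFun⇒framed π framed = subst (λ e → Framed c (m ∸ e) (image π)) c≡d₀ framed

    generated⇒framedOrFlipped′ : ∀ π → Generated S^cd π → FramedOrFlipped (π ⟨$⟩ʳ_)
    generated⇒framedOrFlipped′ π g = generated⇒framedOrFlipped π (subst (λ S → Generated S π) S^cd≡S^cc g)
      where
      S^cd≡S^cc : S^cd ≡ S^ c c m
      S^cd≡S^cc = cong₂ (λ a b → S^ a b m) cOf≡firstBoundary (trans dOf≡n∸lastBoundary (sym c≡d₀))

    generated⇒Comp : ∀ π → Generated S^cd π → Comp m (S_Π f) π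
    generated⇒Comp π g with generated⇒framedOrFlipped′ π g
    ... | inj₁ framed = framed⇒Comp m n≤m π (framedFun⇒framed π framed)
    ... | inj₂ flipped = Comp-extensional m ((π ∘ₚ reverse) ∘ₚ reverse) π (reverse-reverse π)
        (Comp-reverse f pal m (π ∘ₚ reverse) (framed⇒Comp m n≤m (π ∘ₚ reverse) (framedFun⇒framed (π ∘ₚ reverse) flipped)))

    Comp⇒generated : MOf f ≤ suc (suc d) → ∀ π → Comp m (S_Π f) π → Generated S^cd π
    Comp⇒generated M≤ π C with ascending-or-descending π
    ... | inj₁ asc = gen π (framed⇒S^cd π (Comp-ascending⇒framed M≤ π C asc))
    ... | inj₂ desc = ext ((π ∘ₚ reverse) ∘ₚ reverse) π (reverse-reverse π) (comp (π ∘ₚ reverse) reverse πδ∈G (δgen reverse (λ _ → refl)))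
      where
      ascending : Ascending (π ∘ₚ reverse)
      ascending = opposite-< (π ⟨$⟩ʳ fromℕ (d + n)) (π ⟨$⟩ʳ F.zero) desc
      πδ∈G : Generated S^cd (π ∘ₚ reverse)
      πδ∈G = gen (π ∘ₚ reverse) (framed⇒S^cd (π ∘ₚ reverse) (Comp-ascending⇒framed M≤ (π ∘ₚ reverse) (Comp-reverse f pal m π C) ascending))

  palindromic? : Dec (Palindromic f)
  palindromic? = FP.all? (λ j → f (opposite j) Data.Nat.≟ f j)

  small-M⇒characterised : MOf f ≤ suc (suc d) → Characterised
  small-M⇒characterised M≤ with palindromic?
  ... | yes pal = inj₂ (λ π → mk⇔ (Comp⇒generated M≤ π) (generated⇒Comp π))
    where open WhenPalindromic pal
  ... | no ¬pal = inj₁ (λ π → mk⇔ (Comp⇒S^cd π) (λ π∈S → framed⇒Comp m n≤m π (S^cd⇒framed π π∈S)))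
    where
    Comp⇒S^cd : ∀ π → Comp m (S_Π f) π → S^cd π
    Comp⇒S^cd π C with ascending-or-descending π
    ... | inj₁ asc = framed⇒S^cd π (Comp-ascending⇒framed M≤ π C asc)
    ... | inj₂ desc = ⊥-elim (¬pal (Comp-descending⇒palindromic (≤-trans (s≤s z≤n) 2≤n) d π C desc))

  -- A middle block [s, s') with more than d + 2 points contains p = s + d + 1 < t = s' − 1;
  -- their transposition is supported in [s + (m − n), t], hence lies in Comp, yet moves
  -- the middle point p and fixes the middle points s and s'.
  large-M⇒¬characterised : suc (suc d) < MOf f → ¬ Characterised
  large-M⇒¬characterised M> with MOf-attained
  ... | inj₁ M≡1 = ⊥-elim (<⇒≱ M> (subst (_≤ suc (suc d)) (sym M≡1) (s≤s z≤n)))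
  ... | inj₂ (s , s' , bd-s , bd-s' , s<s' , s'-least , M≡) = impossible
    where
    p = s + suc d
    t = s' ∸ 1
    p<t : p < t
    p<t = ≤pred (subst (suc p <_) (m+[n∸m]≡n (<⇒≤ s<s'))
                  (subst (_< s + (s' ∸ s)) (+-suc s (suc d)) (+-monoʳ-< s (subst (suc (suc d) <_) M≡ M>))))
    s'<m : s' < m
    s'<m = <-≤-trans (proj₁ (proj₂ bd-s')) n≤m
    t<m : t < m
    t<m = ≤-<-trans (m∸n≤m s' 1) s'<m
    p<m : p < m
    p<m = <-trans p<t t<m
    s<m : s < m
    s<m = <-trans s<s' s'<m
    point : ∀ {v} → v < m → Fin m
    point v<m = fromℕ< v<m
    π = transpose (point p<m) (point t<m)
    support : FixedOutside (s + (m ∸ n)) t π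
    support x out = cong toℕ (transpose-fixes (point p<m) (point t<m) x (λ e → x≢p (cong toℕ e)) (λ e → x≢t (cong toℕ e)))
      where
      out′ : toℕ x < p ⊎ t < toℕ x
      out′ = subst (λ z → toℕ x < s + z ⊎ t < toℕ x) (m+n∸n≡m (suc d) n) out
      x≢p : toℕ x ≢ toℕ (point p<m)
      x≢p e = [ (λ x<p → <-irrefl (trans e (FP.toℕ-fromℕ< p<m)) x<p)
              , (λ t<x → <⇒≱ t<x (≤-trans (≤-reflexive (trans e (FP.toℕ-fromℕ< p<m))) (<⇒≤ p<t))) ]′ out′
      x≢t : toℕ x ≢ toℕ (point t<m)
      x≢t e = [ (λ x<p → <⇒≱ (<-trans x<p p<t) (≤-reflexive (sym (trans e (FP.toℕ-fromℕ< t<m)))))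
              , (λ t<x → <-irrefl (sym (trans e (FP.toℕ-fromℕ< t<m))) t<x) ]′ out′
    π∈Comp : Comp m (S_Π f) π
    π∈Comp = fixedOutside⇒Comp s s' bd-s s<s' s'-least m n≤m π support
    fixes : ∀ {v} (v<m : v < m) → v < p ⊎ t < v → π ⟨$⟩ʳ point v<m ≡ point v<m
    fixes {v} v<m out = FP.toℕ-injective (support (point v<m) (subst (λ z → z < s + (m ∸ n) ⊎ t < z) (sym (FP.toℕ-fromℕ< v<m))
                          (subst (λ z → v < s + z ⊎ t < v) (sym (m+n∸n≡m (suc d) n)) out)))
    ¬framed : ¬ Framed c (m ∸ d₀) (image π)
    ¬framed framed = <-irrefl (begin
      p                        ≡⟨ FP.toℕ-fromℕ< p<m ⟨
      toℕ (point p<m)          ≡⟨ proj₂ (proj₂ (framed (point p<m))) c≤p p<m∸d₀ ⟨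
      image π (point p<m)      ≡⟨ cong toℕ (transpose-first (point p<m) (point t<m)) ⟩
      toℕ (point t<m)          ≡⟨ FP.toℕ-fromℕ< t<m ⟩
      t                        ∎) p<t
      where
      open ≡-Reasoning
      c≤p : c ≤ toℕ (point p<m)
      c≤p = subst (c ≤_) (sym (FP.toℕ-fromℕ< p<m)) (≤-trans (c-least s bd-s) (m≤m+n s (suc d)))
      p<m∸d₀ : toℕ (point p<m) < m ∸ d₀
      p<m∸d₀ = subst (_< m ∸ d₀) (sym (FP.toℕ-fromℕ< p<m)) (<-trans p<t (≤-<-trans (m∸n≤m s' 1) (≤-<-trans (L-greatest s' bd-s') L<m∸d₀)))
    not-generated : Palindromic f → ¬ Generated S^cd π
    not-generated pal π∈G = [ ¬framed ∘ framedFun⇒framed π , ¬flipped ]′ (generated⇒framedOrFlipped′ π π∈G)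
      where
      open WhenPalindromic pal
      ¬flipped : ¬ FramedFunctions.FramedFun {m} c (m ∸ c) (λ x → opposite (π ⟨$⟩ʳ x))
      ¬flipped flipped = <⇒≢ (+-mono-< s<s' s<s') (suc-injective (trans (sym centre-s) centre-s'))
        where
        centre : ∀ {v} (v<m : v < m) → c ≤ v → v ≤ L → v < p ⊎ t < v → m ≡ suc (v + v)
        centre {v} v<m c≤v v≤L out = subst (λ z → m ≡ suc (z + z)) (FP.toℕ-fromℕ< v<m)
          (flipped-fixedPoint c (π ⟨$⟩ʳ_) flipped (point v<m) (fixes v<m out)
            (subst (c ≤_) (sym (FP.toℕ-fromℕ< v<m)) c≤v)
            (subst₂ _<_ (sym (FP.toℕ-fromℕ< v<m)) (cong (m ∸_) (sym c≡d₀)) (≤-<-trans v≤L L<m∸d₀)))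
        centre-s : m ≡ suc (s + s)
        centre-s = centre s<m (c-least s bd-s) (<⇒≤ (<-≤-trans s<s' (L-greatest s' bd-s'))) (inj₁ (m<m+n s (s≤s z≤n)))
        centre-s' : m ≡ suc (s' + s')
        centre-s' = centre s'<m (c-least s' bd-s') (L-greatest s' bd-s') (inj₂ (≤-reflexive (suc-∸1 (<-≤-trans (s≤s z≤n) s<s'))))
    impossible : ¬ Characterised
    impossible (inj₁ Comp≐S^cd) = ¬framed (S^cd⇒framed π (⇔to (Comp≐S^cd π) π∈Comp))
    impossible (inj₂ Comp≐G) with palindromic?
    ... | no ¬pal = ¬pal (Comp-reverse⇒palindromic f m n≤m (⇔from (Comp≐G reverse) (δgen reverse (λ _ → refl))))
    ... | yes pal = not-generated pal (⇔to (Comp≐G π) π∈Comp)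

twoBlocks⇒2≤n : ∀ {n} (f : Partition n) → AtLeastTwoBlocks f → 2 ≤ n
twoBlocks⇒2≤n {suc zero} f (F.zero , F.zero , f≢) = ⊥-elim (f≢ refl)
twoBlocks⇒2≤n {suc (suc n)} f _ = s≤s (s≤s z≤n)

M∸1⊔1≤1+d⇔M≤2+d : ∀ M d → (M ∸ 1) ⊔ 1 ≤ suc d ⇔ M ≤ suc (suc d)
M∸1⊔1≤1+d⇔M≤2+d M d = mk⇔
  (λ le → ≤-trans (m≤n+m∸n M 1) (s≤s (≤-trans (m≤m⊔n (M ∸ 1) 1) le)))
  (λ M≤ → ⊔-lub (∸-monoˡ-≤ 1 M≤) (s≤s z≤n))

theorem4p10 : (n : ℕ) (Π : Partition n) → AtLeastTwoBlocks Π →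
    ¬ (S_Π Π ≐ S^ (cOf Π) (dOf Π) n) →
    (i : ℕ) → 1 ≤ i →
    ((Comp (n + i) (S_Π Π) ≐ S^ (cOf Π) (dOf Π) (n + i))
    ⊎ (Comp (n + i) (S_Π Π) ≐ Generated (S^ (cOf Π) (dOf Π) (n + i))))
    ⇔ ((MOf Π ∸ 1) ⊔ 1 ≤ i)
theorem4p10 n Π _ _ zero ()
theorem4p10 n Π twoBlocks _ (suc d) _ =
  subst (λ m → CompCharacterised Π m ⇔ ((MOf Π ∸ 1) ⊔ 1 ≤ suc d)) (sym (trans (+-suc n d) (cong suc (+-comm n d))))
    (mk⇔ (λ characterised → ⇔from (M∸1⊔1≤1+d⇔M≤2+d (MOf Π) d) (≮⇒≥ (λ M> → large-M⇒¬characterised M> characterised)))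
         (λ condition → small-M⇒characterised (⇔to (M∸1⊔1≤1+d⇔M≤2+d (MOf Π) d) condition)))
  where open Main Π (twoBlocks⇒2≤n Π twoBlocks) (Boundaries.twoBlocks⇒boundary Π twoBlocks) d
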